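{- Let $q$ be a prime power and let $d, r$ be positive integers. Let $\mathbf{n} = (n_1,\ldots,n_d) \in \mathbb{N}^d$ and $N = n_1 + \cdots + n_d$. The number $\alpha_q(\mathbf{n})$ of $d$-tuples $(p_1,\ldots,p_d)$ of monic polynomials in $F_q[x]$ with $\deg p_i = n_i$ for all $i$ such that $\gcd(p_1,\ldots,p_d)$ is $r$th power free equals $$\alpha_q(\mathbf{n}) = \begin{cases} q^{N} - q^{N+1-rd} & \text{if } \min(n_1,\ldots,n_d) \geq r,\\ q^{N} & \text{if } \min(n_1,\ldots,n_d) \leq r-1.\end{cases}$$
   Context: A polynomial is $r$th power free if no irreducible polynomial divides it with multiplicity $\geq r$. $F_q$ is the finite field with $q$ elements. -}

module Defs where

open import Level using (0ℓ)
open import Data.Nat as ℕ using (ℕ; zero; suc)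
open import Data.Fin as Fin using (Fin)
open import Data.List as List using (List; []; _∷_; _++_)
open import Data.Vec as Vec using (Vec)
open import Data.Vec.Relation.Unary.All as VAll using (All; _∷_)
open import Data.Product using (Σ; ∃; _×_; _,_)
open import Data.Sum using (_⊎_)
open import Data.Nat.Primality using (Prime)
open import Relation.Binary.PropositionalEquality using (_≡_)
open import Relation.Nullary using (¬_)
open import Function.Bundles using (_↔_)
open import Function.Definitions using (Injective)
open import Algebra.Structures using (IsCommutativeRing)

IsPrimePower : ℕ → Set
IsPrimePower q = Σ ℕ λ p → Σ ℕ λ k → Prime p × (q ≡ p ℕ.^ suc k)

record FiniteField (q : ℕ) : Set₁ where
  infixl 6 _+_
  infixl 7 _*_
  field
    Carrier : Set
    _+_ _*_ : Carrier → Carrier → Carrier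
    -_ : Carrier → Carrier
    0# 1# : Carrier
    isCommutativeRing : IsCommutativeRing _≡_ _+_ _*_ -_ 0# 1#
    0≢1 : ¬ (0# ≡ 1#)
    inverse : ∀ x → ¬ (x ≡ 0#) → ∃ λ y → x * y ≡ 1#
    enumeration : Carrier ↔ Fin q

HasCard : {A : Set} → (A → Set) → ℕ → Set
HasCard {A} P k =
  Σ (Fin k → A) λ f →
    (∀ i → P (f i)) × Injective _≡_ _≡_ f × (∀ x → P x → ∃ λ i → f i ≡ x)

module Poly {q : ℕ} (F : FiniteField q) where
  open FiniteField F

  -- polynomials in F[x] as coefficient lists, lowest degree first
  Pol : Set
  Pol = List Carrier

  coeff : Pol → ℕ → Carrier
  coeff []      _       = 0#
  coeff (a ∷ p) zero    = a
  coeff (a ∷ p) (suc k) = coeff p k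

  -- equality of polynomials: all coefficients agree (trailing zeros ignored)
  _≈ₚ_ : Pol → Pol → Set
  p ≈ₚ p′ = ∀ k → coeff p k ≡ coeff p′ k

  _+ₚ_ : Pol → Pol → Pol
  []      +ₚ p′       = p′
  (a ∷ p) +ₚ []       = a ∷ p
  (a ∷ p) +ₚ (b ∷ p′) = (a + b) ∷ (p +ₚ p′)

  _*ₚ_ : Pol → Pol → Pol
  []      *ₚ p′ = []
  (a ∷ p) *ₚ p′ = List.map (a *_) p′ +ₚ (0# ∷ (p *ₚ p′))

  oneₚ : Pol
  oneₚ = 1# ∷ []

  _^ₚ_ : Pol → ℕ → Pol
  p ^ₚ zero  = oneₚ
  p ^ₚ suc k = p *ₚ (p ^ₚ k)

  _∣ₚ_ : Pol → Pol → Set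
  g ∣ₚ p = ∃ λ h → (g *ₚ h) ≈ₚ p

  IsZero : Pol → Set
  IsZero p = p ≈ₚ []

  IsUnit : Pol → Set
  IsUnit u = u ∣ₚ oneₚ

  Irreducible : Pol → Set
  Irreducible g = ¬ IsZero g × ¬ IsUnit g ×
    (∀ a b → (a *ₚ b) ≈ₚ g → IsUnit a ⊎ IsUnit b)

  RthPowerFree : ℕ → Pol → Set
  RthPowerFree r f = ∀ g → Irreducible g → ¬ ((g ^ₚ r) ∣ₚ f)

  -- the monic polynomial of degree n with lower coefficients v
  monic : ∀ {n} → Vec Carrier n → Pol
  monic v = Vec.toList v ++ (1# ∷ [])

  IsGCD : ∀ {d} → Pol → (Fin d → Pol) → Set
  IsGCD g ps = (∃ λ n → Σ (Vec Carrier n) λ v → g ≡ monic v) ×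
    (∀ i → g ∣ₚ ps i) × (∀ c → (∀ i → c ∣ₚ ps i) → c ∣ₚ g)

  Tuple : ∀ {d} → Vec ℕ d → Set
  Tuple ns = All (Vec Carrier) ns

  polys : ∀ {d} {ns : Vec ℕ d} → Tuple ns → Fin d → Pol
  polys (v ∷ t) Fin.zero    = monic v
  polys (v ∷ t) (Fin.suc i) = polys t i

  GcdRthPowerFree : ℕ → ∀ {d} {ns : Vec ℕ d} → Tuple ns → Set
  GcdRthPowerFree r t = ∀ g → IsGCD g (polys t) → RthPowerFree r g

-- Say a tuple has a common r-th power if hʳ divides all its entries for some nonconstant h; over a
-- field this is exactly the failure of the gcd to be r-th power free. Factoring out the largest common
-- r-th power writes every tuple uniquely as Hʳ·u with H monic and u free of common r-th powers, and the
-- tuple has a common r-th power iff deg H ≥ 1. Writing such an H as c + x·h, the map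
-- (c, hʳ·u) ↦ (c + x·h)ʳ·u is a bijection from F_q × {tuples of degrees nᵢ − r} onto the tuples of
-- degrees nᵢ with a common r-th power, so there are q · q^(N − rd) of them. If some nᵢ < r there are none.

module Submission where

open import Level using (0ℓ)
open import Data.Nat as ℕ using (ℕ; zero; suc; _≤_; _<_; z≤n; s≤s)
import Data.Nat.Properties as ℕP
open import Data.Nat.Induction using (<-wellFounded)
open import Induction.WellFounded using (Acc; acc)
open import Data.Fin as Fin using (Fin)
import Data.Fin.Properties as FinP
open import Data.Vec as Vec using (Vec; sum)
import Data.Vec.Properties as VecP
open import Data.Vec.Relation.Unary.All as All using (All)
open import Data.Product using (Σ; ∃; ∃₂; _×_; _,_; proj₁; proj₂)
open import Data.Product.Function.NonDependent.Propositional using (_×-↔_)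
open import Data.Sum as Sum using (_⊎_; inj₁; inj₂)
open import Data.Empty using (⊥-elim)
open import Function using (_∘_; id)
open import Function.Bundles using (Inverse; Injection; _↔_; mk↔ₛ′)
open import Function.Definitions using (Injective)
open import Function.Properties.Inverse using (↔-sym; ↔-trans; ↔⇒↣)
open import Relation.Binary.PropositionalEquality
open import Relation.Nullary using (¬_; Dec; yes; no)
open import Relation.Nullary.Decidable using (map′; via-injection; _×-dec_)
open import Relation.Unary using (Decidable; ∁)
open import Data.List as List using ([]; _∷_)
open import Relation.Binary.Bundles using (Setoid)
open import Relation.Binary.Definitions using (tri<; tri≈; tri>)
import Relation.Binary.Reasoning.Setoid as SetoidReasoning
open import Algebra.Structures using (IsCommutativeRing)
open import Algebra.Bundles using (Ring; CommutativeRing)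
import Algebra.Properties.Ring as RingProperties
import Algebra.Properties.Group as GroupProperties
import Algebra.Solver.Ring.NaturalCoefficients.Default as Solver
open import Defs

module _ {A : Set} where

  HasCard-unique : ∀ {P : A → Set} {m n} → HasCard P m → HasCard P n → m ≡ n
  HasCard-unique (f , fP , f-inj , f-onto) (g , gP , g-inj , g-onto) =
    FinP.cantor-schröder-bernstein (reindex-injective f-inj fP g-onto) (reindex-injective g-inj gP f-onto)
    where
    reindex-injective : ∀ {P : A → Set} {m n} {f : Fin m → A} {g : Fin n → A} →
      Injective _≡_ _≡_ f → (fP : ∀ i → P (f i)) (g-onto : ∀ x → P x → ∃ λ j → g j ≡ x) →
      Injective _≡_ _≡_ (λ i → proj₁ (g-onto (f i) (fP i)))
    reindex-injective {g = g} f-inj fP g-onto {i} {j} e = f-inj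
      (trans (sym (proj₂ (g-onto _ (fP i)))) (trans (cong g e) (proj₂ (g-onto _ (fP j)))))

  HasCard-resp : ∀ {P Q : A → Set} {n} → (∀ x → P x → Q x) → (∀ x → Q x → P x) → HasCard P n → HasCard Q n
  HasCard-resp P⇒Q Q⇒P (f , fP , f-inj , f-onto) = f , P⇒Q _ ∘ fP , f-inj , λ x → f-onto x ∘ Q⇒P x

  HasCard-image : ∀ {B : Set} {P : A → Set} {n} → B ↔ Fin n → (f : B → A) → Injective _≡_ _≡_ f →
    (∀ b → P (f b)) → (∀ x → P x → ∃ λ b → f b ≡ x) → HasCard P n
  HasCard-image e f f-inj fP f-onto =
    f ∘ from , fP ∘ from , Injection.injective (↔⇒↣ (↔-sym e)) ∘ f-inj ,
    λ x Px → let b , fb≡x = f-onto x Px in to b , trans (cong f (strictlyInverseʳ b)) fb≡x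
    where open Inverse e

  HasCard-transport : ∀ {B : Set} {P : A → Set} {k} (e : B ↔ A) → HasCard (P ∘ Inverse.to e) k → HasCard P k
  HasCard-transport {P = P} e (f , fP , f-inj , f-onto) = to ∘ f , fP , f-inj ∘ Injection.injective (↔⇒↣ e) , to-onto
    where
    open Inverse e
    to-onto : ∀ x → P x → ∃ λ i → to (f i) ≡ x
    to-onto x Px = let i , fi≡from-x = f-onto (from x) (subst P (sym (strictlyInverseˡ x)) Px)
                   in i , trans (cong to fi≡from-x) (strictlyInverseˡ x)

module _ {n : ℕ} {P : Fin (suc n) → Set} where

  HasCard-here : ∀ {k} → P Fin.zero → HasCard (P ∘ Fin.suc) k → HasCard P (suc k)
  HasCard-here P0 (f , fP , f-inj , f-onto) = g , gP , g-inj , g-onto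
    where
    g : Fin (suc _) → Fin (suc n)
    g Fin.zero    = Fin.zero
    g (Fin.suc i) = Fin.suc (f i)
    gP : ∀ i → P (g i)
    gP Fin.zero    = P0
    gP (Fin.suc i) = fP i
    g-inj : Injective _≡_ _≡_ g
    g-inj {Fin.zero}  {Fin.zero}  _ = refl
    g-inj {Fin.zero}  {Fin.suc _} ()
    g-inj {Fin.suc _} {Fin.zero}  ()
    g-inj {Fin.suc i} {Fin.suc j} e = cong Fin.suc (f-inj (FinP.suc-injective e))
    g-onto : ∀ x → P x → ∃ λ i → g i ≡ x
    g-onto Fin.zero    _  = Fin.zero , refl
    g-onto (Fin.suc x) Px = let i , fi≡x = f-onto x Px in Fin.suc i , cong Fin.suc fi≡x

  HasCard-there : ∀ {k} → ¬ P Fin.zero → HasCard (P ∘ Fin.suc) k → HasCard P k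
  HasCard-there ¬P0 (f , fP , f-inj , f-onto) = Fin.suc ∘ f , fP , f-inj ∘ FinP.suc-injective , suc-onto
    where
    suc-onto : ∀ x → P x → ∃ λ i → Fin.suc (f i) ≡ x
    suc-onto Fin.zero    P0 = ⊥-elim (¬P0 P0)
    suc-onto (Fin.suc x) Px = let i , fi≡x = f-onto x Px in i , cong Fin.suc fi≡x

HasCard-partition : ∀ n {P : Fin n → Set} → Decidable P →
  ∃₂ λ k l → k ℕ.+ l ≡ n × HasCard P k × HasCard (∁ P) l
HasCard-partition zero    P? = 0 , 0 , refl , none , none
  where
  none : ∀ {Q : Fin 0 → Set} → HasCard Q 0
  none = (λ ()) , (λ ()) , (λ {}) , λ ()
HasCard-partition (suc n) P? with HasCard-partition n (P? ∘ Fin.suc) | P? Fin.zero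
... | k , l , k+l≡n , cardP , card∁P | yes P0 =
  suc k , l , cong suc k+l≡n , HasCard-here P0 cardP , HasCard-there (λ ¬P0 → ¬P0 P0) card∁P
... | k , l , k+l≡n , cardP , card∁P | no ¬P0 =
  k , suc l , trans (ℕP.+-suc k l) (cong suc k+l≡n) , HasCard-there ¬P0 cardP , HasCard-here ¬P0 card∁P

HasCard-∁ : ∀ {A : Set} {P : A → Set} {m n} → A ↔ Fin n → Decidable P → HasCard P m → HasCard (∁ P) (n ℕ.∸ m)
HasCard-∁ {P = P} {m} {n} e P? cardP with HasCard-partition n (P? ∘ Inverse.from e)
... | k , l , k+l≡n , cardP′ , card∁P′ = subst (HasCard (∁ P)) l≡n∸m (HasCard-transport (↔-sym e) card∁P′)
  where
  l≡n∸m : l ≡ n ℕ.∸ m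
  l≡n∸m = trans (sym (ℕP.m+n∸m≡n k l))
    (cong₂ ℕ._∸_ k+l≡n (HasCard-unique (HasCard-transport (↔-sym e) cardP′) cardP))

search : ∀ {A : Set} {n} {P : A → Set} → A ↔ Fin n → Decidable P → Dec (∃ P)
search {P = P} e P? = map′ (λ (i , Pi) → from i , Pi) (λ (x , Px) → to x , subst P (sym (strictlyInverseʳ x)) Px)
  (FinP.any? (P? ∘ from))
  where open Inverse e

module Enumeration {q : ℕ} (F : FiniteField q) where
  open FiniteField F using (enumeration) renaming (Carrier to K)
  open Poly F using (Tuple)

  Vec↔Fin : ∀ n → Vec K n ↔ Fin (q ℕ.^ n)
  Vec↔Fin zero    = mk↔ₛ′ (λ _ → Fin.zero) (λ _ → Vec.[]) (λ { Fin.zero → refl ; (Fin.suc ()) }) (λ { Vec.[] → refl })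
  Vec↔Fin (suc n) = ↔-trans uncons (↔-trans (enumeration ×-↔ Vec↔Fin n) (↔-sym FinP.*↔×))
    where
    uncons : Vec K (suc n) ↔ (K × Vec K n)
    uncons = mk↔ₛ′ (λ { (a Vec.∷ v) → a , v }) (λ (a , v) → a Vec.∷ v) (λ _ → refl) (λ { (a Vec.∷ v) → refl })

  Tuple↔Fin : ∀ {d} (ns : Vec ℕ d) → Tuple ns ↔ Fin (q ℕ.^ sum ns)
  Tuple↔Fin Vec.[]         = mk↔ₛ′ (λ _ → Fin.zero) (λ _ → All.[]) (λ { Fin.zero → refl ; (Fin.suc ()) }) (λ { All.[] → refl })
  Tuple↔Fin (n Vec.∷ ns) = subst (λ m → Tuple (n Vec.∷ ns) ↔ Fin m) (sym (ℕP.^-distribˡ-+-* q n (sum ns)))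
    (↔-trans uncons (↔-trans (Vec↔Fin n ×-↔ Tuple↔Fin ns) (↔-sym FinP.*↔×)))
    where
    uncons : Tuple (n Vec.∷ ns) ↔ (Vec K n × Tuple ns)
    uncons = mk↔ₛ′ (λ { (v All.∷ t) → v , t }) (λ (v , t) → v All.∷ t) (λ _ → refl) (λ { (v All.∷ t) → refl })

  _≟_ : (x y : K) → Dec (x ≡ y)
  _≟_ = via-injection (↔⇒↣ enumeration) FinP._≟_

module Polynomials {q : ℕ} (F : FiniteField q) where
  open FiniteField F renaming (Carrier to K)
  open Poly F renaming (_+ₚ_ to infixl 6 _+ₚ_; _*ₚ_ to infixl 7 _*ₚ_; _^ₚ_ to infixr 8 _^ₚ_)
  open Enumeration F

  K-ring : Ring 0ℓ 0ℓ
  K-ring = record { isRing = IsCommutativeRing.isRing isCommutativeRing }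

  module K where
    open IsCommutativeRing isCommutativeRing public
    open RingProperties K-ring public using (-0#≈0#)

  -- Ring laws

  infix 4 _≈_
  -- A record rather than _≈ₚ_ itself, so that both polynomials can be inferred from an equation.
  record _≈_ (p s : Pol) : Set where
    constructor mk≈
    field coeff-≡ : ∀ k → coeff p k ≡ coeff s k
  open _≈_ public

  ≈-refl : ∀ {p} → p ≈ p
  ≈-refl = mk≈ λ _ → refl

  ≈-sym : ∀ {p s} → p ≈ s → s ≈ p
  ≈-sym e = mk≈ λ k → sym (coeff-≡ e k)

  ≈-trans : ∀ {p s t} → p ≈ s → s ≈ t → p ≈ t
  ≈-trans e e′ = mk≈ λ k → trans (coeff-≡ e k) (coeff-≡ e′ k)

  ≈-setoid : Setoid 0ℓ 0ℓ
  ≈-setoid = record { Carrier = Pol ; _≈_ = _≈_ ; isEquivalence = record { refl = ≈-refl ; sym = ≈-sym ; trans = ≈-trans } }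

  module ≈-Reasoning = SetoidReasoning ≈-setoid

  scale : K → Pol → Pol
  scale a p = List.map (a *_) p

  infix 8 -ₚ_
  -ₚ_ : Pol → Pol
  -ₚ_ = List.map -_

  coeff-+ : ∀ p s k → coeff (p +ₚ s) k ≡ coeff p k + coeff s k
  coeff-+ []      s       k       = sym (K.+-identityˡ _)
  coeff-+ (a ∷ p) []      k       = sym (K.+-identityʳ _)
  coeff-+ (a ∷ p) (b ∷ s) zero    = refl
  coeff-+ (a ∷ p) (b ∷ s) (suc k) = coeff-+ p s k

  coeff-scale : ∀ a p k → coeff (scale a p) k ≡ a * coeff p k
  coeff-scale a []      k       = sym (K.zeroʳ a)
  coeff-scale a (b ∷ p) zero    = refl
  coeff-scale a (b ∷ p) (suc k) = coeff-scale a p k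

  coeff-neg : ∀ p k → coeff (-ₚ p) k ≡ - coeff p k
  coeff-neg []      k       = sym K.-0#≈0#
  coeff-neg (b ∷ p) zero    = refl
  coeff-neg (b ∷ p) (suc k) = coeff-neg p k

  ∷-cong : ∀ {a b p s} → a ≡ b → p ≈ s → a ∷ p ≈ b ∷ s
  ∷-cong a≡b p≈s = mk≈ λ where
    zero    → a≡b
    (suc k) → coeff-≡ p≈s k

  tail : Pol → Pol
  tail []      = []
  tail (a ∷ p) = p

  coeff-tail : ∀ p k → coeff (tail p) k ≡ coeff p (suc k)
  coeff-tail []      k = refl
  coeff-tail (a ∷ p) k = refl

  tail-cong : ∀ {p s} → p ≈ s → tail p ≈ tail s
  tail-cong {p} {s} e = mk≈ λ k → trans (coeff-tail p k) (trans (coeff-≡ e (suc k)) (sym (coeff-tail s k)))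

  0∷-≈[] : ∀ {p} → p ≈ [] → 0# ∷ p ≈ []
  0∷-≈[] p≈0 = mk≈ λ where
    zero    → refl
    (suc k) → coeff-≡ p≈0 k

  +-cong : ∀ {p p′ s s′} → p ≈ p′ → s ≈ s′ → p +ₚ s ≈ p′ +ₚ s′
  +-cong {p} {p′} {s} {s′} e e′ = mk≈ λ k → trans (coeff-+ p s k)
    (trans (cong₂ _+_ (coeff-≡ e k) (coeff-≡ e′ k)) (sym (coeff-+ p′ s′ k)))

  scale-cong : ∀ {a b p s} → a ≡ b → p ≈ s → scale a p ≈ scale b s
  scale-cong {a} {b} {p} {s} e e′ = mk≈ λ k → trans (coeff-scale a p k)
    (trans (cong₂ _*_ e (coeff-≡ e′ k)) (sym (coeff-scale b s k)))

  neg-cong : ∀ {p s} → p ≈ s → -ₚ p ≈ -ₚ s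
  neg-cong {p} {s} e = mk≈ λ k → trans (coeff-neg p k) (trans (cong -_ (coeff-≡ e k)) (sym (coeff-neg s k)))

  +-comm : ∀ p s → p +ₚ s ≈ s +ₚ p
  +-comm p s = mk≈ λ k → trans (coeff-+ p s k) (trans (K.+-comm _ _) (sym (coeff-+ s p k)))

  +-assoc : ∀ p s t → p +ₚ s +ₚ t ≈ p +ₚ (s +ₚ t)
  +-assoc p s t = mk≈ λ k → begin
    coeff (p +ₚ s +ₚ t) k                 ≡⟨ coeff-+ (p +ₚ s) t k ⟩
    coeff (p +ₚ s) k + coeff t k          ≡⟨ cong (_+ coeff t k) (coeff-+ p s k) ⟩
    coeff p k + coeff s k + coeff t k     ≡⟨ K.+-assoc _ _ _ ⟩
    coeff p k + (coeff s k + coeff t k)   ≡⟨ cong (coeff p k +_) (coeff-+ s t k) ⟨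
    coeff p k + coeff (s +ₚ t) k          ≡⟨ coeff-+ p (s +ₚ t) k ⟨
    coeff (p +ₚ (s +ₚ t)) k               ∎
    where open ≡-Reasoning

  +-identityʳ : ∀ p → p +ₚ [] ≈ p
  +-identityʳ []      = ≈-refl
  +-identityʳ (a ∷ p) = ≈-refl

  -‿inverseʳ : ∀ p → p +ₚ -ₚ p ≈ []
  -‿inverseʳ p = mk≈ λ k → trans (coeff-+ p (-ₚ p) k) (trans (cong (coeff p k +_) (coeff-neg p k)) (K.-‿inverseʳ _))

  -‿inverseˡ : ∀ p → -ₚ p +ₚ p ≈ []
  -‿inverseˡ p = ≈-trans (+-comm (-ₚ p) p) (-‿inverseʳ p)

  +-interchange : ∀ a b c d → (a +ₚ b) +ₚ (c +ₚ d) ≈ (a +ₚ c) +ₚ (b +ₚ d)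
  +-interchange a b c d = begin
    (a +ₚ b) +ₚ (c +ₚ d)   ≈⟨ +-assoc a b (c +ₚ d) ⟩
    a +ₚ (b +ₚ (c +ₚ d))   ≈⟨ +-cong (≈-refl {a}) (≈-sym (+-assoc b c d)) ⟩
    a +ₚ (b +ₚ c +ₚ d)     ≈⟨ +-cong (≈-refl {a}) (+-cong (+-comm b c) (≈-refl {d})) ⟩
    a +ₚ (c +ₚ b +ₚ d)     ≈⟨ +-cong (≈-refl {a}) (+-assoc c b d) ⟩
    a +ₚ (c +ₚ (b +ₚ d))   ≈⟨ +-assoc a c (b +ₚ d) ⟨
    (a +ₚ c) +ₚ (b +ₚ d)   ∎
    where open ≈-Reasoning

  scale-distribˡ : ∀ a p s → scale a (p +ₚ s) ≈ scale a p +ₚ scale a s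
  scale-distribˡ a p s = mk≈ λ k → begin
    coeff (scale a (p +ₚ s)) k                ≡⟨ coeff-scale a (p +ₚ s) k ⟩
    a * coeff (p +ₚ s) k                      ≡⟨ cong (a *_) (coeff-+ p s k) ⟩
    a * (coeff p k + coeff s k)               ≡⟨ K.distribˡ a _ _ ⟩
    a * coeff p k + a * coeff s k             ≡⟨ cong₂ _+_ (coeff-scale a p k) (coeff-scale a s k) ⟨
    coeff (scale a p) k + coeff (scale a s) k ≡⟨ coeff-+ (scale a p) (scale a s) k ⟨
    coeff (scale a p +ₚ scale a s) k          ∎
    where open ≡-Reasoning

  scale-distribʳ : ∀ a b p → scale (a + b) p ≈ scale a p +ₚ scale b p
  scale-distribʳ a b p = mk≈ λ k → begin
    coeff (scale (a + b) p) k                 ≡⟨ coeff-scale (a + b) p k ⟩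
    (a + b) * coeff p k                       ≡⟨ K.distribʳ _ a b ⟩
    a * coeff p k + b * coeff p k             ≡⟨ cong₂ _+_ (coeff-scale a p k) (coeff-scale b p k) ⟨
    coeff (scale a p) k + coeff (scale b p) k ≡⟨ coeff-+ (scale a p) (scale b p) k ⟨
    coeff (scale a p +ₚ scale b p) k          ∎
    where open ≡-Reasoning

  scale-assoc : ∀ a b p → scale a (scale b p) ≈ scale (a * b) p
  scale-assoc a b p = mk≈ λ k → trans (coeff-scale a (scale b p) k)
    (trans (cong (a *_) (coeff-scale b p k)) (trans (sym (K.*-assoc a b _)) (sym (coeff-scale (a * b) p k))))

  scale-identity : ∀ p → scale 1# p ≈ p
  scale-identity p = mk≈ λ k → trans (coeff-scale 1# p k) (K.*-identityˡ _)

  scale-zero : ∀ p → scale 0# p ≈ []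
  scale-zero p = mk≈ λ k → trans (coeff-scale 0# p k) (K.zeroˡ _)

  *-congˡ : ∀ {p p′} s → p ≈ p′ → p *ₚ s ≈ p′ *ₚ s
  *-congˡ {[]}    {[]}     s e = ≈-refl
  *-congˡ {[]}    {b ∷ p′} s e = ≈-sym (+-cong (≈-trans (scale-cong (sym (coeff-≡ e zero)) ≈-refl) (scale-zero s))
                                                (0∷-≈[] (≈-sym (*-congˡ {[]} {p′} s (tail-cong e)))))
  *-congˡ {a ∷ p} {[]}     s e = +-cong (≈-trans (scale-cong (coeff-≡ e zero) ≈-refl) (scale-zero s))
                                         (0∷-≈[] (*-congˡ {p} {[]} s (tail-cong e)))
  *-congˡ {a ∷ p} {b ∷ p′} s e = +-cong (scale-cong (coeff-≡ e zero) ≈-refl) (∷-cong refl (*-congˡ {p} {p′} s (tail-cong e)))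

  *-congʳ : ∀ p {s s′} → s ≈ s′ → p *ₚ s ≈ p *ₚ s′
  *-congʳ []      e = ≈-refl
  *-congʳ (a ∷ p) e = +-cong (scale-cong refl e) (∷-cong refl (*-congʳ p e))

  *-cong : ∀ {p p′ s s′} → p ≈ p′ → s ≈ s′ → p *ₚ s ≈ p′ *ₚ s′
  *-cong {p} {p′} {s} e e′ = ≈-trans (*-congˡ s e) (*-congʳ p′ e′)

  0∷-+ : ∀ p s → 0# ∷ (p +ₚ s) ≈ (0# ∷ p) +ₚ (0# ∷ s)
  0∷-+ p s = ∷-cong (sym (K.+-identityˡ 0#)) ≈-refl

  *-distribʳ : ∀ s p p′ → (p +ₚ p′) *ₚ s ≈ p *ₚ s +ₚ p′ *ₚ s
  *-distribʳ s []      p′       = ≈-refl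
  *-distribʳ s (a ∷ p) []       = ≈-sym (+-identityʳ _)
  *-distribʳ s (a ∷ p) (b ∷ p′) = begin
    scale (a + b) s +ₚ (0# ∷ (p +ₚ p′) *ₚ s)                      ≈⟨ +-cong (scale-distribʳ a b s) (∷-cong refl (*-distribʳ s p p′)) ⟩
    (scale a s +ₚ scale b s) +ₚ (0# ∷ (p *ₚ s +ₚ p′ *ₚ s))        ≈⟨ +-cong (≈-refl {scale a s +ₚ scale b s}) (0∷-+ (p *ₚ s) (p′ *ₚ s)) ⟩
    (scale a s +ₚ scale b s) +ₚ ((0# ∷ p *ₚ s) +ₚ (0# ∷ p′ *ₚ s)) ≈⟨ +-interchange (scale a s) (scale b s) _ _ ⟩
    (scale a s +ₚ (0# ∷ p *ₚ s)) +ₚ (scale b s +ₚ (0# ∷ p′ *ₚ s)) ∎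
    where open ≈-Reasoning

  *-distribˡ : ∀ p s s′ → p *ₚ (s +ₚ s′) ≈ p *ₚ s +ₚ p *ₚ s′
  *-distribˡ []      s s′ = ≈-refl
  *-distribˡ (a ∷ p) s s′ = begin
    scale a (s +ₚ s′) +ₚ (0# ∷ p *ₚ (s +ₚ s′))                     ≈⟨ +-cong (scale-distribˡ a s s′) (∷-cong refl (*-distribˡ p s s′)) ⟩
    (scale a s +ₚ scale a s′) +ₚ (0# ∷ (p *ₚ s +ₚ p *ₚ s′))        ≈⟨ +-cong (≈-refl {scale a s +ₚ scale a s′}) (0∷-+ (p *ₚ s) (p *ₚ s′)) ⟩
    (scale a s +ₚ scale a s′) +ₚ ((0# ∷ p *ₚ s) +ₚ (0# ∷ p *ₚ s′)) ≈⟨ +-interchange (scale a s) (scale a s′) _ _ ⟩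
    (scale a s +ₚ (0# ∷ p *ₚ s)) +ₚ (scale a s′ +ₚ (0# ∷ p *ₚ s′)) ∎
    where open ≈-Reasoning

  *-zeroʳ : ∀ p → p *ₚ [] ≈ []
  *-zeroʳ []      = ≈-refl
  *-zeroʳ (a ∷ p) = 0∷-≈[] (*-zeroʳ p)

  *-∷ʳ : ∀ p b s → p *ₚ (b ∷ s) ≈ scale b p +ₚ (0# ∷ p *ₚ s)
  *-∷ʳ []      b s = ≈-sym (0∷-≈[] ≈-refl)
  *-∷ʳ (a ∷ p) b s = ∷-cong (cong (_+ 0#) (K.*-comm a b)) (begin
    scale a s +ₚ p *ₚ (b ∷ s)                        ≈⟨ +-cong (≈-refl {scale a s}) (*-∷ʳ p b s) ⟩
    scale a s +ₚ (scale b p +ₚ (0# ∷ p *ₚ s))        ≈⟨ +-assoc (scale a s) (scale b p) _ ⟨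
    scale a s +ₚ scale b p +ₚ (0# ∷ p *ₚ s)          ≈⟨ +-cong (+-comm (scale a s) (scale b p)) ≈-refl ⟩
    scale b p +ₚ scale a s +ₚ (0# ∷ p *ₚ s)          ≈⟨ +-assoc (scale b p) (scale a s) _ ⟩
    scale b p +ₚ (scale a s +ₚ (0# ∷ p *ₚ s))        ∎)
    where open ≈-Reasoning

  *-comm : ∀ p s → p *ₚ s ≈ s *ₚ p
  *-comm []      s = ≈-sym (*-zeroʳ s)
  *-comm (a ∷ p) s = ≈-trans (+-cong (≈-refl {scale a s}) (∷-cong refl (*-comm p s))) (≈-sym (*-∷ʳ s a p))

  scale-* : ∀ a p s → scale a (p *ₚ s) ≈ scale a p *ₚ s
  scale-* a []      s = ≈-refl
  scale-* a (b ∷ p) s = begin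
    scale a (scale b s +ₚ (0# ∷ p *ₚ s))              ≈⟨ scale-distribˡ a (scale b s) _ ⟩
    scale a (scale b s) +ₚ (a * 0# ∷ scale a (p *ₚ s)) ≈⟨ +-cong (scale-assoc a b s) (∷-cong (K.zeroʳ a) (scale-* a p s)) ⟩
    scale (a * b) s +ₚ (0# ∷ scale a p *ₚ s)           ∎
    where open ≈-Reasoning

  *-assoc : ∀ p s t → p *ₚ s *ₚ t ≈ p *ₚ (s *ₚ t)
  *-assoc []      s t = ≈-refl
  *-assoc (a ∷ p) s t = begin
    (scale a s +ₚ (0# ∷ p *ₚ s)) *ₚ t          ≈⟨ *-distribʳ t (scale a s) _ ⟩
    scale a s *ₚ t +ₚ (0# ∷ p *ₚ s) *ₚ t       ≈⟨ +-cong (≈-sym (scale-* a s t)) (+-cong (scale-zero t) (≈-refl {0# ∷ p *ₚ s *ₚ t})) ⟩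
    scale a (s *ₚ t) +ₚ (0# ∷ p *ₚ s *ₚ t)     ≈⟨ +-cong (≈-refl {scale a (s *ₚ t)}) (∷-cong refl (*-assoc p s t)) ⟩
    scale a (s *ₚ t) +ₚ (0# ∷ p *ₚ (s *ₚ t))   ∎
    where open ≈-Reasoning

  *-identityˡ : ∀ p → oneₚ *ₚ p ≈ p
  *-identityˡ p = ≈-trans (+-cong (scale-identity p) (0∷-≈[] ≈-refl)) (+-identityʳ p)

  *-identityʳ : ∀ p → p *ₚ oneₚ ≈ p
  *-identityʳ p = ≈-trans (*-comm p oneₚ) (*-identityˡ p)

  commutativeRing : CommutativeRing 0ℓ 0ℓ
  commutativeRing = record
    { Carrier = Pol ; _≈_ = _≈_ ; _+_ = _+ₚ_ ; _*_ = _*ₚ_ ; -_ = -ₚ_ ; 0# = [] ; 1# = oneₚ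
    ; isCommutativeRing = record
      { isRing = record
        { +-isAbelianGroup = record
          { isGroup = record
            { isMonoid = record
              { isSemigroup = record
                { isMagma = record { isEquivalence = Setoid.isEquivalence ≈-setoid ; ∙-cong = +-cong }
                ; assoc = +-assoc }
              ; identity = (λ _ → ≈-refl) , +-identityʳ }
            ; inverse = -‿inverseˡ , -‿inverseʳ
            ; ⁻¹-cong = neg-cong }
          ; comm = +-comm }
        ; *-cong = *-cong
        ; *-assoc = *-assoc
        ; *-identity = *-identityˡ , *-identityʳ
        ; distrib = *-distribˡ , *-distribʳ }
      ; *-comm = *-comm } }

  open Solver (CommutativeRing.commutativeSemiring commutativeRing) using (solve; _:=_; _:+_; _:*_)
  private
    module PR = RingProperties (CommutativeRing.ring commutativeRing)
    module PG = GroupProperties (CommutativeRing.+-group commutativeRing)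

  infixl 6 _-ₚ_
  _-ₚ_ : Pol → Pol → Pol
  p -ₚ s = p +ₚ -ₚ s

  ^-cong : ∀ {p s} k → p ≈ s → p ^ₚ k ≈ s ^ₚ k
  ^-cong zero    e = ≈-refl
  ^-cong (suc k) e = *-cong e (^-cong k e)

  ^-distribʳ-* : ∀ p s k → (p *ₚ s) ^ₚ k ≈ p ^ₚ k *ₚ s ^ₚ k
  ^-distribʳ-* p s zero    = ≈-sym (*-identityˡ oneₚ)
  ^-distribʳ-* p s (suc k) = ≈-trans (*-cong (≈-refl {p *ₚ s}) (^-distribʳ-* p s k))
    (solve 4 (λ p s a b → p :* s :* (a :* b) := p :* a :* (s :* b)) ≈-refl p s (p ^ₚ k) (s ^ₚ k))

  1^ : ∀ k → oneₚ ^ₚ k ≈ oneₚ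
  1^ zero    = ≈-refl
  1^ (suc k) = ≈-trans (*-identityˡ _) (1^ k)

  -- Degrees

  1#≢0# : ¬ 1# ≡ 0#
  1#≢0# = 0≢1 ∘ sym

  inv : (x : K) → ¬ x ≡ 0# → K
  inv x x≢0 = proj₁ (inverse x x≢0)

  *-inverseʳ : ∀ x (x≢0 : ¬ x ≡ 0#) → x * inv x x≢0 ≡ 1#
  *-inverseʳ x x≢0 = proj₂ (inverse x x≢0)

  *-inverseˡ : ∀ x (x≢0 : ¬ x ≡ 0#) → inv x x≢0 * x ≡ 1#
  *-inverseˡ x x≢0 = trans (K.*-comm _ x) (*-inverseʳ x x≢0)

  x*y≢0 : ∀ {x y} → ¬ x ≡ 0# → ¬ y ≡ 0# → ¬ x * y ≡ 0#
  x*y≢0 {x} {y} x≢0 y≢0 xy≡0 = y≢0 (begin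
    y                  ≡⟨ K.*-identityˡ y ⟨
    1# * y             ≡⟨ cong (_* y) (*-inverseˡ x x≢0) ⟨
    inv x x≢0 * x * y  ≡⟨ K.*-assoc _ x y ⟩
    inv x x≢0 * (x * y) ≡⟨ cong (inv x x≢0 *_) xy≡0 ⟩
    inv x x≢0 * 0#     ≡⟨ K.zeroʳ _ ⟩
    0#                 ∎)
    where open ≡-Reasoning

  DegreeAtMost : Pol → ℕ → Set
  DegreeAtMost p n = ∀ j → n < j → coeff p j ≡ 0#

  record HasDegree (p : Pol) (n : ℕ) : Set where
    constructor hasDegree
    field
      atMost    : DegreeAtMost p n
      leading≢0 : ¬ coeff p n ≡ 0#

  record MonicOfDegree (p : Pol) (n : ℕ) : Set where
    constructor monicOfDegree
    field
      atMost    : DegreeAtMost p n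
      leading≡1 : coeff p n ≡ 1#

  DegreeAtMost-cong : ∀ {p s n} → p ≈ s → DegreeAtMost p n → DegreeAtMost s n
  DegreeAtMost-cong e p≤n j n<j = trans (sym (coeff-≡ e j)) (p≤n j n<j)

  HasDegree-cong : ∀ {p s n} → p ≈ s → HasDegree p n → HasDegree s n
  HasDegree-cong {n = n} e (hasDegree p≤n lead) = hasDegree (DegreeAtMost-cong e p≤n) (lead ∘ trans (coeff-≡ e n))

  MonicOfDegree-cong : ∀ {p s n} → p ≈ s → MonicOfDegree p n → MonicOfDegree s n
  MonicOfDegree-cong {n = n} e (monicOfDegree p≤n lead) = monicOfDegree (DegreeAtMost-cong e p≤n) (trans (sym (coeff-≡ e n)) lead)

  Monic⇒HasDegree : ∀ {p n} → MonicOfDegree p n → HasDegree p n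
  Monic⇒HasDegree (monicOfDegree p≤n lead) = hasDegree p≤n (1#≢0# ∘ trans (sym lead))

  HasDegree-unique : ∀ {p m n} → HasDegree p m → HasDegree p n → m ≡ n
  HasDegree-unique {m = m} {n} (hasDegree p≤m lead-m) (hasDegree p≤n lead-n) with ℕP.<-cmp m n
  ... | tri< m<n _ _ = ⊥-elim (lead-n (p≤m n m<n))
  ... | tri≈ _ m≡n _ = m≡n
  ... | tri> _ _ n<m = ⊥-elim (lead-m (p≤n m n<m))

  coeff-∷-* : ∀ a p s j → coeff ((a ∷ p) *ₚ s) j ≡ a * coeff s j + coeff (0# ∷ p *ₚ s) j
  coeff-∷-* a p s j = trans (coeff-+ (scale a s) (0# ∷ p *ₚ s) j) (cong (_+ _) (coeff-scale a s j))

  *-leading : ∀ p s n m → DegreeAtMost p n → DegreeAtMost s m →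
    DegreeAtMost (p *ₚ s) (n ℕ.+ m) × coeff (p *ₚ s) (n ℕ.+ m) ≡ coeff p n * coeff s m
  *-leading []      s n       m p≤n s≤m = (λ _ _ → refl) , sym (K.zeroˡ _)
  *-leading (a ∷ p) s zero    m p≤0 s≤m = ps≤m , coeff-as m
    where
    ps≈[] : p *ₚ s ≈ []
    ps≈[] = *-congˡ {p} {[]} s (mk≈ λ j → p≤0 (suc j) (s≤s z≤n))
    coeff-as : ∀ j → coeff ((a ∷ p) *ₚ s) j ≡ a * coeff s j
    coeff-as j = trans (coeff-∷-* a p s j) (trans (cong (a * coeff s j +_) (coeff-≡ (0∷-≈[] ps≈[]) j)) (K.+-identityʳ _))
    ps≤m : DegreeAtMost ((a ∷ p) *ₚ s) m
    ps≤m j m<j = trans (coeff-as j) (trans (cong (a *_) (s≤m j m<j)) (K.zeroʳ a))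
  *-leading (a ∷ p) s (suc n) m p≤1+n s≤m = ps≤1+n+m , leading
    where
    ih = *-leading p s n m (λ j n<j → p≤1+n (suc j) (s≤s n<j)) s≤m
    ps≤1+n+m : DegreeAtMost ((a ∷ p) *ₚ s) (suc n ℕ.+ m)
    ps≤1+n+m (suc j) (s≤s n+m<j) = begin
      coeff ((a ∷ p) *ₚ s) (suc j)           ≡⟨ coeff-∷-* a p s (suc j) ⟩
      a * coeff s (suc j) + coeff (p *ₚ s) j ≡⟨ cong₂ (λ u v → a * u + v) (s≤m (suc j) (s≤s (ℕP.≤-trans (ℕP.m≤n+m m n) (ℕP.<⇒≤ n+m<j)))) (proj₁ ih j n+m<j) ⟩
      a * 0# + 0#                            ≡⟨ K.+-identityʳ _ ⟩
      a * 0#                                 ≡⟨ K.zeroʳ a ⟩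
      0#                                     ∎
      where open ≡-Reasoning
    leading : coeff ((a ∷ p) *ₚ s) (suc n ℕ.+ m) ≡ coeff p n * coeff s m
    leading = begin
      coeff ((a ∷ p) *ₚ s) (suc (n ℕ.+ m))                   ≡⟨ coeff-∷-* a p s (suc (n ℕ.+ m)) ⟩
      a * coeff s (suc (n ℕ.+ m)) + coeff (p *ₚ s) (n ℕ.+ m) ≡⟨ cong (λ u → a * u + coeff (p *ₚ s) (n ℕ.+ m)) (s≤m _ (s≤s (ℕP.m≤n+m m n))) ⟩
      a * 0# + coeff (p *ₚ s) (n ℕ.+ m)                      ≡⟨ cong (_+ coeff (p *ₚ s) (n ℕ.+ m)) (K.zeroʳ a) ⟩
      0# + coeff (p *ₚ s) (n ℕ.+ m)                          ≡⟨ K.+-identityˡ _ ⟩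
      coeff (p *ₚ s) (n ℕ.+ m)                               ≡⟨ proj₂ ih ⟩
      coeff p n * coeff s m                                  ∎
      where open ≡-Reasoning

  HasDegree-* : ∀ {p s n m} → HasDegree p n → HasDegree s m → HasDegree (p *ₚ s) (n ℕ.+ m)
  HasDegree-* {p} {s} {n} {m} (hasDegree p≤n lead-p) (hasDegree s≤m lead-s) =
    let ps≤n+m , leading = *-leading p s n m p≤n s≤m
    in hasDegree ps≤n+m (x*y≢0 lead-p lead-s ∘ trans (sym leading))

  MonicOfDegree-* : ∀ {p s n m} → MonicOfDegree p n → MonicOfDegree s m → MonicOfDegree (p *ₚ s) (n ℕ.+ m)
  MonicOfDegree-* {p} {s} {n} {m} (monicOfDegree p≤n lead-p) (monicOfDegree s≤m lead-s) =
    let ps≤n+m , leading = *-leading p s n m p≤n s≤m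
    in monicOfDegree ps≤n+m (trans leading (trans (cong₂ _*_ lead-p lead-s) (K.*-identityˡ 1#)))

  HasDegree-one : HasDegree oneₚ 0
  HasDegree-one = hasDegree (λ { (suc j) _ → refl }) 1#≢0#

  MonicOfDegree-^ : ∀ {p n} k → MonicOfDegree p n → MonicOfDegree (p ^ₚ k) (k ℕ.* n)
  MonicOfDegree-^ zero    _   = monicOfDegree (λ { (suc j) _ → refl }) refl
  MonicOfDegree-^ (suc k) p-n = MonicOfDegree-* p-n (MonicOfDegree-^ k p-n)

  HasDegree-^ : ∀ {p n} k → HasDegree p n → HasDegree (p ^ₚ k) (k ℕ.* n)
  HasDegree-^ zero    _   = HasDegree-one
  HasDegree-^ (suc k) p-n = HasDegree-* p-n (HasDegree-^ k p-n)

  ≈[]⊎HasDegree : ∀ p → p ≈ [] ⊎ ∃ (HasDegree p)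
  ≈[]⊎HasDegree []      = inj₁ ≈-refl
  ≈[]⊎HasDegree (a ∷ p) with ≈[]⊎HasDegree p
  ... | inj₂ (n , hasDegree p≤n lead) = inj₂ (suc n , hasDegree (λ { (suc j) (s≤s n<j) → p≤n j n<j }) lead)
  ... | inj₁ p≈[] with a ≟ 0#
  ...   | yes a≡0 = inj₁ (≈-trans (∷-cong a≡0 p≈[]) (0∷-≈[] ≈-refl))
  ...   | no a≢0  = inj₂ (0 , hasDegree (λ { (suc j) _ → coeff-≡ p≈[] j }) a≢0)

  HasDegree⇒≉[] : ∀ {p n} → HasDegree p n → ¬ p ≈ []
  HasDegree⇒≉[] {n = n} (hasDegree _ lead) p≈[] = lead (coeff-≡ p≈[] n)

  monic⇒≉[] : ∀ {p n} → MonicOfDegree p n → ¬ p ≈ []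
  monic⇒≉[] = HasDegree⇒≉[] ∘ Monic⇒HasDegree

  ≈[]? : ∀ p → Dec (p ≈ [])
  ≈[]? p with ≈[]⊎HasDegree p
  ... | inj₁ p≈[]      = yes p≈[]
  ... | inj₂ (_ , p-n) = no (HasDegree⇒≉[] p-n)

  *≈[]⇒≈[]⊎≈[] : ∀ {p s} → p *ₚ s ≈ [] → p ≈ [] ⊎ s ≈ []
  *≈[]⇒≈[]⊎≈[] {p} {s} ps≈[] with ≈[]⊎HasDegree p | ≈[]⊎HasDegree s
  ... | inj₁ p≈[]      | _              = inj₁ p≈[]
  ... | inj₂ _         | inj₁ s≈[]      = inj₂ s≈[]
  ... | inj₂ (_ , p-n) | inj₂ (_ , s-m) = ⊥-elim (HasDegree⇒≉[] (HasDegree-* p-n s-m) ps≈[])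

  *-cancelˡ : ∀ {g a b} → ¬ g ≈ [] → g *ₚ a ≈ g *ₚ b → a ≈ b
  *-cancelˡ {g} {a} {b} g≉[] ga≈gb with *≈[]⇒≈[]⊎≈[] (≈-trans (PR.x[y-z]≈xy-xz g a b) (PG.x≈y⇒x∙y⁻¹≈ε ga≈gb))
  ... | inj₁ g≈[]   = ⊥-elim (g≉[] g≈[])
  ... | inj₂ a-b≈[] = PG.x∙y⁻¹≈ε⇒x≈y a b a-b≈[]

  -- Divisibility

  infix 4 _∣_
  record _∣_ (g p : Pol) : Set where
    constructor divides
    field
      quotient : Pol
      equality : g *ₚ quotient ≈ p

  ∣-refl : ∀ p → p ∣ p
  ∣-refl p = divides oneₚ (*-identityʳ p)

  ∣-resp-≈ : ∀ {g g′ p p′} → g ≈ g′ → p ≈ p′ → g ∣ p → g′ ∣ p′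
  ∣-resp-≈ {g} {g′} g≈g′ p≈p′ (divides h gh≈p) = divides h (≈-trans (*-congˡ h (≈-sym g≈g′)) (≈-trans gh≈p p≈p′))

  ∣-trans : ∀ {a b c} → a ∣ b → b ∣ c → a ∣ c
  ∣-trans {a} (divides h ah≈b) (divides h′ bh′≈c) =
    divides (h *ₚ h′) (≈-trans (≈-sym (*-assoc a h h′)) (≈-trans (*-congˡ h′ ah≈b) bh′≈c))

  g∣g*s : ∀ g s → g ∣ g *ₚ s
  g∣g*s g s = divides s ≈-refl

  ∣-*ʳ : ∀ {g p} s → g ∣ p → g ∣ p *ₚ s
  ∣-*ʳ {p = p} s g∣p = ∣-trans g∣p (g∣g*s p s)

  ∣-*ˡ : ∀ {g p} s → g ∣ p → g ∣ s *ₚ p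
  ∣-*ˡ {p = p} s g∣p = ∣-resp-≈ ≈-refl (*-comm p s) (∣-*ʳ s g∣p)

  ∣-+ : ∀ {g a b} → g ∣ a → g ∣ b → g ∣ a +ₚ b
  ∣-+ {g} (divides h gh≈a) (divides h′ gh′≈b) = divides (h +ₚ h′) (≈-trans (*-distribˡ g h h′) (+-cong gh≈a gh′≈b))

  1∣ : ∀ p → oneₚ ∣ p
  1∣ p = divides p (*-identityˡ p)

  *-pres-∣ : ∀ {a b c d} → a ∣ b → c ∣ d → a *ₚ c ∣ b *ₚ d
  *-pres-∣ {a} {b} {c} {d} (divides h ah≈b) (divides h′ ch′≈d) = divides (h *ₚ h′)
    (≈-trans (solve 4 (λ a c h h′ → a :* c :* (h :* h′) := a :* h :* (c :* h′)) ≈-refl a c h h′) (*-cong ah≈b ch′≈d))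

  ^-pres-∣ : ∀ {g h} k → g ∣ h → g ^ₚ k ∣ h ^ₚ k
  ^-pres-∣ zero    _   = ∣-refl oneₚ
  ^-pres-∣ (suc k) g∣h = *-pres-∣ g∣h (^-pres-∣ k g∣h)

  ∣⇒degree≤ : ∀ {g p a b} → g ∣ p → HasDegree g a → HasDegree p b → a ≤ b
  ∣⇒degree≤ {g} {a = a} (divides h gh≈p) g-a p-b with ≈[]⊎HasDegree h
  ... | inj₁ h≈[]      = ⊥-elim (HasDegree⇒≉[] p-b (≈-trans (≈-sym gh≈p) (≈-trans (*-congʳ g h≈[]) (*-zeroʳ g))))
  ... | inj₂ (c , h-c) = subst (a ≤_) (HasDegree-unique (HasDegree-cong gh≈p (HasDegree-* g-a h-c)) p-b) (ℕP.m≤m+n a c)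

  Invertible : Pol → Set
  Invertible u = u ∣ oneₚ

  invertible⇒degree0 : ∀ {u} → Invertible u → HasDegree u 0
  invertible⇒degree0 {u} (divides w uw≈1) with ≈[]⊎HasDegree u | ≈[]⊎HasDegree w
  ... | inj₁ u≈[]      | _              = ⊥-elim (HasDegree⇒≉[] HasDegree-one (≈-trans (≈-sym uw≈1) (*-congˡ w u≈[])))
  ... | inj₂ _         | inj₁ w≈[]      = ⊥-elim (HasDegree⇒≉[] HasDegree-one (≈-trans (≈-sym uw≈1) (≈-trans (*-congʳ u w≈[]) (*-zeroʳ u))))
  ... | inj₂ (n , u-n) | inj₂ (m , w-m) =
    subst (HasDegree u) (ℕP.m+n≡0⇒m≡0 n (HasDegree-unique (HasDegree-cong uw≈1 (HasDegree-* u-n w-m)) HasDegree-one)) u-n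

  C : K → Pol
  C a = a ∷ []

  X : Pol
  X = 0# ∷ oneₚ

  C-* : ∀ a b → C a *ₚ C b ≈ C (a * b)
  C-* a b = mk≈ λ { zero → K.+-identityʳ _ ; (suc j) → refl }

  C-inverseˡ : ∀ a (a≢0 : ¬ a ≡ 0#) → C (inv a a≢0) *ₚ C a ≈ oneₚ
  C-inverseˡ a a≢0 = ≈-trans (C-* _ a) (∷-cong (*-inverseˡ a a≢0) ≈-refl)

  degree0⇒invertible : ∀ {u} → HasDegree u 0 → Invertible u
  degree0⇒invertible {u} (hasDegree u≤0 u0≢0) = divides (C (inv (coeff u 0) u0≢0))
    (≈-trans (*-comm u _) (≈-trans (*-congʳ (C (inv (coeff u 0) u0≢0)) u≈C) (C-inverseˡ (coeff u 0) u0≢0)))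
    where
    u≈C : u ≈ C (coeff u 0)
    u≈C = mk≈ λ { zero → refl ; (suc j) → u≤0 (suc j) (s≤s z≤n) }

  scale≈C* : ∀ a p → scale a p ≈ C a *ₚ p
  scale≈C* a p = ≈-sym (≈-trans (+-cong (≈-refl {scale a p}) (0∷-≈[] ≈-refl)) (+-identityʳ (scale a p)))

  coeff-C* : ∀ a p j → coeff (C a *ₚ p) j ≡ a * coeff p j
  coeff-C* a p j = trans (sym (coeff-≡ (scale≈C* a p) j)) (coeff-scale a p j)

  X*≈0∷ : ∀ p → X *ₚ p ≈ 0# ∷ p
  X*≈0∷ p = +-cong (scale-zero p) (∷-cong refl (*-identityˡ p))

  ∷≈C+X* : ∀ a p → a ∷ p ≈ C a +ₚ X *ₚ p
  ∷≈C+X* a p = ≈-sym (≈-trans (+-cong (≈-refl {C a}) (X*≈0∷ p)) (∷-cong (K.+-identityʳ a) ≈-refl))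

  -- Monic polynomials and their coefficient vectors

  coeffs : (n : ℕ) → Pol → Vec K n
  coeffs zero    p = Vec.[]
  coeffs (suc n) p = coeff p 0 Vec.∷ coeffs n (tail p)

  coeffs-cong : ∀ n {p s} → p ≈ s → coeffs n p ≡ coeffs n s
  coeffs-cong zero    _   = refl
  coeffs-cong (suc n) p≈s = cong₂ Vec._∷_ (coeff-≡ p≈s 0) (coeffs-cong n (tail-cong p≈s))

  coeffs-monic : ∀ {n} (v : Vec K n) → coeffs n (monic v) ≡ v
  coeffs-monic Vec.[]       = refl
  coeffs-monic (a Vec.∷ v) = cong (a Vec.∷_) (coeffs-monic v)

  monic-MonicOfDegree : ∀ {n} (v : Vec K n) → MonicOfDegree (monic v) n
  monic-MonicOfDegree Vec.[]       = monicOfDegree (λ { (suc j) _ → refl }) refl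
  monic-MonicOfDegree (a Vec.∷ v) with monic-MonicOfDegree v
  ... | monicOfDegree v≤n lead = monicOfDegree (λ { (suc j) (s≤s n<j) → v≤n j n<j }) lead

  monic-coeffs : ∀ {p} n → MonicOfDegree p n → monic (coeffs n p) ≈ p
  monic-coeffs {p} zero    (monicOfDegree p≤0 lead) = mk≈ λ { zero → sym lead ; (suc j) → sym (p≤0 (suc j) (s≤s z≤n)) }
  monic-coeffs {p} (suc n) (monicOfDegree p≤n lead) = ≈-trans (∷-cong refl (monic-coeffs n tail-monic))
    (mk≈ λ { zero → refl ; (suc j) → coeff-tail p j })
    where
    tail-monic : MonicOfDegree (tail p) n
    tail-monic = monicOfDegree (λ j n<j → trans (coeff-tail p j) (p≤n (suc j) (s≤s n<j))) (trans (coeff-tail p n) lead)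

  record Normalised (p : Pol) (n : ℕ) : Set where
    constructor normalised
    field
      leading   : K
      leading≢0 : ¬ leading ≡ 0#
      {monicPart} : Pol
      monicPart-monic : MonicOfDegree monicPart n
      p≈C*monicPart : p ≈ C leading *ₚ monicPart

  normalise : ∀ {p n} → HasDegree p n → Normalised p n
  normalise {p} {n} (hasDegree p≤n c≢0) = normalised c c≢0 (monicOfDegree c⁻¹p≤n lead) p≈
    where
    c  = coeff p n
    c⁻¹ = inv c c≢0
    c⁻¹p≤n : DegreeAtMost (C c⁻¹ *ₚ p) n
    c⁻¹p≤n j n<j = trans (coeff-C* c⁻¹ p j) (trans (cong (c⁻¹ *_) (p≤n j n<j)) (K.zeroʳ c⁻¹))
    lead : coeff (C c⁻¹ *ₚ p) n ≡ 1#
    lead = trans (coeff-C* c⁻¹ p n) (*-inverseˡ c c≢0)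
    p≈ : p ≈ C c *ₚ (C c⁻¹ *ₚ p)
    p≈ = ≈-sym (begin
      C c *ₚ (C c⁻¹ *ₚ p) ≈⟨ solve 3 (λ c c⁻¹ p → c :* (c⁻¹ :* p) := c⁻¹ :* c :* p) ≈-refl (C c) (C c⁻¹) p ⟩
      C c⁻¹ *ₚ C c *ₚ p   ≈⟨ *-congˡ p (C-inverseˡ c c≢0) ⟩
      oneₚ *ₚ p           ≈⟨ *-identityˡ p ⟩
      p                   ∎)
      where open ≈-Reasoning

  monic-divisor : ∀ {p n} → HasDegree p n → Σ (Vec K n) λ v → monic v ∣ p
  monic-divisor {p} {n} p-n = coeffs n m , divides (C c) (≈-trans (*-congˡ (C c) (monic-coeffs n m-monic))
                                                          (≈-trans (*-comm m (C c)) (≈-sym p≈)))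
    where
    open Normalised (normalise p-n)
      renaming (leading to c; monicPart to m; monicPart-monic to m-monic; p≈C*monicPart to p≈)

  quotient-monic : ∀ {g w a n} → MonicOfDegree g a → MonicOfDegree (g *ₚ w) n → ∃ λ b → MonicOfDegree w b × a ℕ.+ b ≡ n
  quotient-monic {g} {w} {a} {n} g-a gw-n with ≈[]⊎HasDegree w
  ... | inj₁ w≈[] = ⊥-elim (monic⇒≉[] gw-n (≈-trans (*-congʳ g w≈[]) (*-zeroʳ g)))
  ... | inj₂ (b , hasDegree w≤b lead-w) = b , monicOfDegree w≤b lead-w≡1 , a+b≡n
    where
    open MonicOfDegree g-a renaming (atMost to g≤a; leading≡1 to lead-g)
    gw≤a+b = proj₁ (*-leading g w a b g≤a w≤b)
    lead-gw : coeff (g *ₚ w) (a ℕ.+ b) ≡ coeff g a * coeff w b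
    lead-gw = proj₂ (*-leading g w a b g≤a w≤b)
    a+b≡n : a ℕ.+ b ≡ n
    a+b≡n = HasDegree-unique (hasDegree gw≤a+b (x*y≢0 (1#≢0# ∘ trans (sym lead-g)) lead-w ∘ trans (sym lead-gw)))
                             (Monic⇒HasDegree gw-n)
    lead-w≡1 : coeff w b ≡ 1#
    lead-w≡1 = begin
      coeff w b              ≡⟨ K.*-identityˡ _ ⟨
      1# * coeff w b         ≡⟨ cong (_* coeff w b) lead-g ⟨
      coeff g a * coeff w b  ≡⟨ lead-gw ⟨
      coeff (g *ₚ w) (a ℕ.+ b) ≡⟨ cong (coeff (g *ₚ w)) a+b≡n ⟩
      coeff (g *ₚ w) n       ≡⟨ MonicOfDegree.leading≡1 gw-n ⟩
      1#                     ∎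
      where open ≡-Reasoning

  -- Division with remainder, greatest common divisors and irreducible factors

  DegreeBelow : Pol → ℕ → Set
  DegreeBelow p n = ∀ j → n ≤ j → coeff p j ≡ 0#

  record Division (g : Pol) (k : ℕ) (p : Pol) : Set where
    constructor division
    field
      quotient remainder : Pol
      p≈gq+r             : p ≈ g *ₚ quotient +ₚ remainder
      remainder<k        : DegreeBelow remainder k

  divide : ∀ {g k} → MonicOfDegree g k → ∀ p → Division g k p
  divide {g} {k} g-k []      = division [] [] (≈-sym (≈-trans (+-identityʳ _) (*-zeroʳ g))) (λ _ _ → refl)
  divide {g} {k} g-k (a ∷ p) with divide g-k p
  ... | division s ρ p≈gs+ρ ρ<k = division ((0# ∷ s) +ₚ C c) ((a ∷ ρ) -ₚ scale c g) a∷p≈ ρ′<k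
    where
    -- a ∷ ρ = a + x·ρ has degree at most k, and subtracting c·g removes its xᵏ term.
    c = coeff (a ∷ ρ) k
    a∷p≈ : a ∷ p ≈ g *ₚ ((0# ∷ s) +ₚ C c) +ₚ ((a ∷ ρ) -ₚ scale c g)
    a∷p≈ = begin
      a ∷ p                                                ≈⟨ ∷-cong refl p≈gs+ρ ⟩
      a ∷ (g *ₚ s +ₚ ρ)                                    ≈⟨ ∷≈C+X* a _ ⟩
      C a +ₚ X *ₚ (g *ₚ s +ₚ ρ)                            ≈⟨ PG.x≈z//y _ (C c *ₚ g) _
        (solve 6 (λ A x g s ρ C → A :+ x :* (g :* s :+ ρ) :+ C :* g := g :* (x :* s :+ C) :+ (A :+ x :* ρ))
                 ≈-refl (C a) X g s ρ (C c)) ⟩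
      g *ₚ (X *ₚ s +ₚ C c) +ₚ (C a +ₚ X *ₚ ρ) -ₚ C c *ₚ g ≈⟨ +-assoc (g *ₚ (X *ₚ s +ₚ C c)) (C a +ₚ X *ₚ ρ) _ ⟩
      g *ₚ (X *ₚ s +ₚ C c) +ₚ (C a +ₚ X *ₚ ρ -ₚ C c *ₚ g) ≈⟨ +-cong (*-congʳ g (+-cong (X*≈0∷ s) (≈-refl {C c})))
                                                                    (+-cong (≈-sym (∷≈C+X* a ρ)) (neg-cong (≈-sym (scale≈C* c g)))) ⟩
      g *ₚ ((0# ∷ s) +ₚ C c) +ₚ ((a ∷ ρ) -ₚ scale c g)       ∎
      where open ≈-Reasoning
    coeff-ρ′ : ∀ j → coeff ((a ∷ ρ) -ₚ scale c g) j ≡ coeff (a ∷ ρ) j + - (c * coeff g j)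
    coeff-ρ′ j = trans (coeff-+ (a ∷ ρ) (-ₚ scale c g) j) (cong (coeff (a ∷ ρ) j +_) (trans (coeff-neg (scale c g) j) (cong -_ (coeff-scale c g j))))
    a∷ρ≤k : DegreeAtMost (a ∷ ρ) k
    a∷ρ≤k (suc j) (s≤s k≤j) = ρ<k j k≤j
    ρ′<k : DegreeBelow ((a ∷ ρ) -ₚ scale c g) k
    ρ′<k j k≤j with ℕP.m≤n⇒m<n∨m≡n k≤j
    ... | inj₂ refl = begin
      coeff ((a ∷ ρ) -ₚ scale c g) k ≡⟨ coeff-ρ′ k ⟩
      c + - (c * coeff g k)        ≡⟨ cong (λ u → c + - (c * u)) (MonicOfDegree.leading≡1 g-k) ⟩
      c + - (c * 1#)               ≡⟨ cong (λ u → c + - u) (K.*-identityʳ c) ⟩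
      c + - c                      ≡⟨ K.-‿inverseʳ c ⟩
      0#                           ∎
      where open ≡-Reasoning
    ... | inj₁ k<j = begin
      coeff ((a ∷ ρ) -ₚ scale c g) j ≡⟨ coeff-ρ′ j ⟩
      coeff (a ∷ ρ) j + - (c * coeff g j) ≡⟨ cong₂ (λ u v → u + - (c * v)) (a∷ρ≤k j k<j) (MonicOfDegree.atMost g-k j k<j) ⟩
      0# + - (c * 0#)              ≡⟨ cong (λ u → 0# + - u) (K.zeroʳ c) ⟩
      0# + - 0#                    ≡⟨ K.+-identityˡ _ ⟩
      - 0#                         ≡⟨ K.-0#≈0# ⟩
      0#                           ∎
      where open ≡-Reasoning

  ∣⇒remainder≈[] : ∀ {g k p} → MonicOfDegree g k → (D : Division g k p) → g ∣ p → Division.remainder D ≈ []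
  ∣⇒remainder≈[] {g} {k} {p} g-k (division s ρ p≈gs+ρ ρ<k) (divides w gw≈p) = case (≈[]⊎HasDegree (w -ₚ s))
    where
    ρ≈g[w-s] : ρ ≈ g *ₚ (w -ₚ s)
    ρ≈g[w-s] = begin
      ρ                ≈⟨ PG.x≈z//y ρ (g *ₚ s) p (≈-trans (+-comm ρ (g *ₚ s)) (≈-sym p≈gs+ρ)) ⟩
      p -ₚ g *ₚ s      ≈⟨ +-cong (≈-sym gw≈p) ≈-refl ⟩
      g *ₚ w -ₚ g *ₚ s ≈⟨ PR.x[y-z]≈xy-xz g w s ⟨
      g *ₚ (w -ₚ s)    ∎
      where open ≈-Reasoning
    case : w -ₚ s ≈ [] ⊎ ∃ (HasDegree (w -ₚ s)) → ρ ≈ []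
    case (inj₁ w-s≈[])      = ≈-trans ρ≈g[w-s] (≈-trans (*-congʳ g w-s≈[]) (*-zeroʳ g))
    case (inj₂ (m , w-s-m)) = ⊥-elim (HasDegree.leading≢0 ρ-k+m (ρ<k (k ℕ.+ m) (ℕP.m≤m+n k m)))
      where
      ρ-k+m : HasDegree ρ (k ℕ.+ m)
      ρ-k+m = HasDegree-cong (≈-sym ρ≈g[w-s]) (HasDegree-* (Monic⇒HasDegree g-k) w-s-m)

  ∣? : ∀ {g k} → MonicOfDegree g k → ∀ p → Dec (g ∣ p)
  ∣? {g} g-k p with divide g-k p
  ... | D@(division s ρ p≈gs+ρ _) with ≈[]? ρ
  ...   | yes ρ≈[] = yes (divides s (≈-sym (≈-trans p≈gs+ρ (≈-trans (+-cong (≈-refl {g *ₚ s}) ρ≈[]) (+-identityʳ _)))))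
  ...   | no ρ≉[]  = no (ρ≉[] ∘ ∣⇒remainder≈[] g-k D)

  record BezoutGcd (a b : Pol) : Set where
    constructor bezoutGcd
    field
      {degree}     : ℕ
      coefficients : Vec K degree
      gcd∣a        : monic coefficients ∣ a
      gcd∣b        : monic coefficients ∣ b
      s t          : Pol
      bezout       : monic coefficients ≈ s *ₚ a +ₚ t *ₚ b

  HasDegree-below : ∀ {ρ j k} → DegreeBelow ρ k → HasDegree ρ j → j < k
  HasDegree-below {j = j} {k} ρ<k (hasDegree _ lead) with j ℕP.<? k
  ... | yes j<k = j<k
  ... | no j≮k  = ⊥-elim (lead (ρ<k j (ℕP.≮⇒≥ j≮k)))

  extendedGcd : ∀ {g k} → Acc _<_ k → MonicOfDegree g k → ∀ p → BezoutGcd g p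
  extendedGcd {g} {k} (acc rec) g-k p = from-remainder (≈[]⊎HasDegree ρ)
    where
    open Division (divide g-k p) renaming (quotient to s; remainder to ρ; p≈gq+r to p≈gs+ρ; remainder<k to ρ<k)
    ρ≈p-gs : ρ ≈ p -ₚ g *ₚ s
    ρ≈p-gs = PG.x≈z//y ρ (g *ₚ s) p (≈-trans (+-comm ρ (g *ₚ s)) (≈-sym p≈gs+ρ))
    from-remainder : ρ ≈ [] ⊎ ∃ (HasDegree ρ) → BezoutGcd g p
    from-remainder (inj₁ ρ≈[]) = bezoutGcd (coeffs k g) (∣-resp-≈ (≈-sym G≈g) ≈-refl (∣-refl g))
                                   (∣-resp-≈ (≈-sym G≈g) (≈-sym p≈gs) (g∣g*s g s)) oneₚ [] G≈1g+0p
      where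
      G≈g : monic (coeffs k g) ≈ g
      G≈g = monic-coeffs k g-k
      p≈gs : p ≈ g *ₚ s
      p≈gs = ≈-trans p≈gs+ρ (≈-trans (+-cong (≈-refl {g *ₚ s}) ρ≈[]) (+-identityʳ _))
      G≈1g+0p : monic (coeffs k g) ≈ oneₚ *ₚ g +ₚ [] *ₚ p
      G≈1g+0p = ≈-trans G≈g (≈-sym (≈-trans (+-identityʳ (oneₚ *ₚ g)) (*-identityˡ g)))
    from-remainder (inj₂ (j , ρ-j)) = bezoutGcd v G∣g G∣p (t′ -ₚ w *ₚ s) w G≈
      where
      open Normalised (normalise ρ-j) renaming (leading to c; leading≢0 to c≢0; monicPart to m;
                                                monicPart-monic to m-j; p≈C*monicPart to ρ≈cm)
      open BezoutGcd (extendedGcd (rec (HasDegree-below ρ<k ρ-j)) m-j g)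
        renaming (coefficients to v; gcd∣a to G∣m; gcd∣b to G∣g; s to s′; t to t′; bezout to G≈s′m+t′g)
      G = monic v
      c⁻¹ = inv c c≢0
      w = s′ *ₚ C c⁻¹
      G∣p : G ∣ p
      G∣p = ∣-resp-≈ ≈-refl (≈-sym (≈-trans p≈gs+ρ (+-cong (≈-refl {g *ₚ s}) ρ≈cm)))
              (∣-+ (∣-*ʳ s G∣g) (∣-*ˡ (C c) G∣m))
      m≈c⁻¹ρ : m ≈ C c⁻¹ *ₚ ρ
      m≈c⁻¹ρ = ≈-sym (begin
        C c⁻¹ *ₚ ρ            ≈⟨ *-congʳ (C c⁻¹) ρ≈cm ⟩
        C c⁻¹ *ₚ (C c *ₚ m)   ≈⟨ *-assoc (C c⁻¹) (C c) m ⟨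
        C c⁻¹ *ₚ C c *ₚ m     ≈⟨ *-congˡ m (C-inverseˡ c c≢0) ⟩
        oneₚ *ₚ m             ≈⟨ *-identityˡ m ⟩
        m                     ∎)
        where open ≈-Reasoning
      G≈ : G ≈ (t′ -ₚ w *ₚ s) *ₚ g +ₚ w *ₚ p
      G≈ = begin
        G                                   ≈⟨ G≈s′m+t′g ⟩
        s′ *ₚ m +ₚ t′ *ₚ g                  ≈⟨ +-cong (≈-trans (*-congʳ s′ m≈c⁻¹ρ) (≈-sym (*-assoc s′ _ ρ))) (≈-refl {t′ *ₚ g}) ⟩
        w *ₚ ρ +ₚ t′ *ₚ g                   ≈⟨ +-cong (≈-trans (*-congʳ w ρ≈p-gs) (PR.x[y-z]≈xy-xz w p (g *ₚ s))) (≈-refl {t′ *ₚ g}) ⟩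
        w *ₚ p -ₚ w *ₚ (g *ₚ s) +ₚ t′ *ₚ g  ≈⟨ +-cong (+-cong (≈-refl {w *ₚ p}) (neg-cong (solve 3 (λ w g s → w :* (g :* s) := w :* s :* g) ≈-refl w g s))) (≈-refl {t′ *ₚ g}) ⟩
        w *ₚ p -ₚ w *ₚ s *ₚ g +ₚ t′ *ₚ g    ≈⟨ solve 3 (λ a b c → a :+ b :+ c := c :+ b :+ a) ≈-refl (w *ₚ p) (-ₚ (w *ₚ s *ₚ g)) (t′ *ₚ g) ⟩
        t′ *ₚ g -ₚ w *ₚ s *ₚ g +ₚ w *ₚ p    ≈⟨ +-cong (PR.[y-z]x≈yx-zx g t′ (w *ₚ s)) (≈-refl {w *ₚ p}) ⟨
        (t′ -ₚ w *ₚ s) *ₚ g +ₚ w *ₚ p       ∎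
        where open ≈-Reasoning

  record IsIrreducible (g : Pol) : Set where
    constructor isIrreducible
    field
      nonzero : ¬ g ≈ []
      nonunit : ¬ Invertible g
      split   : ∀ a b → a *ₚ b ≈ g → Invertible a ⊎ Invertible b

  ∣ₚ⇒∣ : ∀ {g p} → g ∣ₚ p → g ∣ p
  ∣ₚ⇒∣ (h , gh≈p) = divides h (mk≈ gh≈p)

  ∣⇒∣ₚ : ∀ {g p} → g ∣ p → g ∣ₚ p
  ∣⇒∣ₚ (divides h gh≈p) = h , coeff-≡ gh≈p

  Irreducible⇒IsIrreducible : ∀ {g} → Irreducible g → IsIrreducible g
  Irreducible⇒IsIrreducible (g≉0 , nonunit , split) = isIrreducible (g≉0 ∘ coeff-≡) (nonunit ∘ ∣⇒∣ₚ)
    λ a b ab≈g → Sum.map ∣ₚ⇒∣ ∣ₚ⇒∣ (split a b (coeff-≡ ab≈g))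

  IsIrreducible⇒Irreducible : ∀ {g} → IsIrreducible g → Irreducible g
  IsIrreducible⇒Irreducible (isIrreducible g≉0 nonunit split) = g≉0 ∘ mk≈ , nonunit ∘ ∣ₚ⇒∣ ,
    λ a b ab≈g → Sum.map ∣⇒∣ₚ ∣⇒∣ₚ (split a b (mk≈ ab≈g))

  IsIrreducible⇒degree≥1 : ∀ {g} → IsIrreducible g → ∃ λ k → 1 ≤ k × HasDegree g k
  IsIrreducible⇒degree≥1 {g} (isIrreducible g≉0 nonunit _) with ≈[]⊎HasDegree g
  ... | inj₁ g≈[]           = ⊥-elim (g≉0 g≈[])
  ... | inj₂ (zero , g-0)   = ⊥-elim (nonunit (degree0⇒invertible g-0))
  ... | inj₂ (suc k , g-k)  = suc k , s≤s z≤n , g-k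

  euclidsLemma : ∀ {g k a b} → MonicOfDegree g k → IsIrreducible g → g ∣ a *ₚ b → g ∣ a ⊎ g ∣ b
  euclidsLemma {g} {k} {a} {b} g-k (isIrreducible _ _ split) g∣ab
    with extendedGcd (<-wellFounded k) g-k a
  ... | bezoutGcd v (divides e Ge≈g) G∣a s t G≈sg+ta with split (monic v) e Ge≈g
  ...   | inj₂ (divides w ew≈1) = inj₁ (∣-trans (divides w gw≈G) G∣a)
    where
    gw≈G : g *ₚ w ≈ monic v
    gw≈G = begin
      g *ₚ w                ≈⟨ *-congˡ w Ge≈g ⟨
      monic v *ₚ e *ₚ w     ≈⟨ *-assoc (monic v) e w ⟩
      monic v *ₚ (e *ₚ w)   ≈⟨ *-congʳ (monic v) ew≈1 ⟩
      monic v *ₚ oneₚ       ≈⟨ *-identityʳ (monic v) ⟩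
      monic v               ∎
      where open ≈-Reasoning
  ...   | inj₁ (divides w Gw≈1) = inj₂ (∣-resp-≈ ≈-refl b≈ (∣-*ˡ w (∣-+ (g∣g*s g (s *ₚ b)) (∣-*ˡ t g∣ab))))
    where
    G = monic v
    b≈ : w *ₚ (g *ₚ (s *ₚ b) +ₚ t *ₚ (a *ₚ b)) ≈ b
    b≈ = begin
      w *ₚ (g *ₚ (s *ₚ b) +ₚ t *ₚ (a *ₚ b)) ≈⟨ solve 6 (λ w g s b t a → w :* (g :* (s :* b) :+ t :* (a :* b)) := w :* ((s :* g :+ t :* a) :* b)) ≈-refl w g s b t a ⟩
      w *ₚ ((s *ₚ g +ₚ t *ₚ a) *ₚ b)        ≈⟨ *-congʳ w (*-congˡ b G≈sg+ta) ⟨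
      w *ₚ (G *ₚ b)                         ≈⟨ solve 3 (λ w G b → w :* (G :* b) := G :* w :* b) ≈-refl w G b ⟩
      G *ₚ w *ₚ b                           ≈⟨ *-congˡ b Gw≈1 ⟩
      oneₚ *ₚ b                             ≈⟨ *-identityˡ b ⟩
      b                                     ∎
      where open ≈-Reasoning

  euclidsLemma-^ : ∀ {g k h} r → MonicOfDegree g k → IsIrreducible g → g ∣ h ^ₚ r → g ∣ h
  euclidsLemma-^ zero    _   g-irr g∣1 = ⊥-elim (IsIrreducible.nonunit g-irr g∣1)
  euclidsLemma-^ (suc r) g-k g-irr g∣hʳ⁺¹ with euclidsLemma g-k g-irr g∣hʳ⁺¹
  ... | inj₁ g∣h  = g∣h
  ... | inj₂ g∣hʳ = euclidsLemma-^ r g-k g-irr g∣hʳ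

  ^-∣-*-coprimeˡ : ∀ {g k a b} s → MonicOfDegree g k → IsIrreducible g → ¬ g ∣ a → g ^ₚ s ∣ a *ₚ b → g ^ₚ s ∣ b
  ^-∣-*-coprimeˡ zero    _   _     _    _ = 1∣ _
  ^-∣-*-coprimeˡ {g} {k} {a} {b} (suc s) g-k g-irr g∤a (divides h gˢ⁺¹h≈ab)
    with euclidsLemma g-k g-irr (divides (g ^ₚ s *ₚ h) (≈-trans (≈-sym (*-assoc g (g ^ₚ s) h)) gˢ⁺¹h≈ab))
  ... | inj₁ g∣a = ⊥-elim (g∤a g∣a)
  ... | inj₂ (divides b′ gb′≈b) = ∣-resp-≈ ≈-refl gb′≈b (*-pres-∣ (∣-refl g) (^-∣-*-coprimeˡ s g-k g-irr g∤a (divides h gˢh≈ab′)))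
    where
    gˢh≈ab′ : g ^ₚ s *ₚ h ≈ a *ₚ b′
    gˢh≈ab′ = *-cancelˡ (IsIrreducible.nonzero g-irr) (begin
      g *ₚ (g ^ₚ s *ₚ h) ≈⟨ *-assoc g (g ^ₚ s) h ⟨
      g ^ₚ suc s *ₚ h    ≈⟨ gˢ⁺¹h≈ab ⟩
      a *ₚ b             ≈⟨ *-congʳ a gb′≈b ⟨
      a *ₚ (g *ₚ b′)     ≈⟨ solve 3 (λ a g b → a :* (g :* b) := g :* (a :* b)) ≈-refl a g b′ ⟩
      g *ₚ (a *ₚ b′)     ∎)
      where open ≈-Reasoning

  record IrreducibleFactor (h : Pol) : Set where
    constructor irreducibleFactor
    field
      {factor degree} : _
      factor-monic    : MonicOfDegree factor degree
      degree≥1        : 1 ≤ degree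
      irreducible     : IsIrreducible factor
      factor∣h        : factor ∣ h

  PositiveDegreeMonicDivisor : Pol → ℕ → Set
  PositiveDegreeMonicDivisor h j = 1 ≤ j × Σ (Vec K j) λ v → monic v ∣ h

  PositiveDegreeMonicDivisor? : ∀ h j → Dec (PositiveDegreeMonicDivisor h j)
  PositiveDegreeMonicDivisor? h j = (1 ℕP.≤? j) ×-dec search (Vec↔Fin j) (λ v → ∣? (monic-MonicOfDegree v) h)

  minimal-divisor-irreducible : ∀ {h k} → MonicOfDegree h k → 1 ≤ k →
    ¬ (∃ λ j → j < k × PositiveDegreeMonicDivisor h j) → IsIrreducible h
  minimal-divisor-irreducible {h} {k} h-k k≥1 no-smaller = isIrreducible h≉[] nonunit split
    where
    h≉[] = monic⇒≉[] h-k
    nonunit : ¬ Invertible h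
    nonunit u = ℕP.<⇒≢ k≥1 (HasDegree-unique (invertible⇒degree0 u) (Monic⇒HasDegree h-k))
    split : ∀ a b → a *ₚ b ≈ h → Invertible a ⊎ Invertible b
    split a b ab≈h with ≈[]⊎HasDegree a | ≈[]⊎HasDegree b
    ... | inj₁ a≈[]           | _                  = ⊥-elim (h≉[] (≈-trans (≈-sym ab≈h) (*-congˡ b a≈[])))
    ... | inj₂ _              | inj₁ b≈[]          = ⊥-elim (h≉[] (≈-trans (≈-sym ab≈h) (≈-trans (*-congʳ a b≈[]) (*-zeroʳ a))))
    ... | inj₂ (zero , a-0)   | _                  = inj₁ (degree0⇒invertible a-0)
    ... | inj₂ (suc _ , _)    | inj₂ (zero , b-0)  = inj₂ (degree0⇒invertible b-0)
    ... | inj₂ (suc x , a-x)  | inj₂ (suc y , b-y) =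
      ⊥-elim (no-smaller (suc x , x<k , s≤s z≤n , proj₁ (monic-divisor a-x) , ∣-trans (proj₂ (monic-divisor a-x)) (divides b ab≈h)))
      where
      x<k : suc x < k
      x<k = subst (suc x <_) (HasDegree-unique (HasDegree-cong ab≈h (HasDegree-* a-x b-y)) (Monic⇒HasDegree h-k))
                  (ℕP.m<m+n (suc x) (s≤s z≤n))

  irreducible-factor : ∀ {h k} → Acc _<_ k → MonicOfDegree h k → 1 ≤ k → IrreducibleFactor h
  irreducible-factor {h} {k} (acc rec) h-k k≥1 with ℕP.anyUpTo? (PositiveDegreeMonicDivisor? h) k
  ... | yes (j , j<k , j≥1 , v , v∣h) =
    let irreducibleFactor f-monic f≥1 f-irr f∣v = irreducible-factor (rec j<k) (monic-MonicOfDegree v) j≥1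
    in irreducibleFactor f-monic f≥1 f-irr (∣-trans f∣v v∣h)
  ... | no no-smaller = irreducibleFactor h-k k≥1 (minimal-divisor-irreducible h-k k≥1 no-smaller) (∣-refl h)

  -- Tuples and common r-th powers

  polys-monic : ∀ {d} {ns : Vec ℕ d} (t : Tuple ns) i → MonicOfDegree (polys t i) (Vec.lookup ns i)
  polys-monic (v All.∷ t) Fin.zero    = monic-MonicOfDegree v
  polys-monic (v All.∷ t) (Fin.suc i) = polys-monic t i

  tabulateTuple : ∀ {d} (ns : Vec ℕ d) → (Fin d → Pol) → Tuple ns
  tabulateTuple Vec.[]         f = All.[]
  tabulateTuple (n Vec.∷ ns) f = coeffs n (f Fin.zero) All.∷ tabulateTuple ns (f ∘ Fin.suc)

  polys-tabulate : ∀ {d} (ns : Vec ℕ d) {f} → (∀ i → MonicOfDegree (f i) (Vec.lookup ns i)) →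
    ∀ i → polys (tabulateTuple ns f) i ≈ f i
  polys-tabulate (n Vec.∷ ns) f-monic Fin.zero    = monic-coeffs n (f-monic Fin.zero)
  polys-tabulate (n Vec.∷ ns) f-monic (Fin.suc i) = polys-tabulate ns (f-monic ∘ Fin.suc) i

  tabulate-polys : ∀ {d} {ns : Vec ℕ d} {f} (t : Tuple ns) → (∀ i → f i ≈ polys t i) → tabulateTuple ns f ≡ t
  tabulate-polys All.[]            f≈ = refl
  tabulate-polys {ns = n Vec.∷ _} (v All.∷ t) f≈ =
    cong₂ All._∷_ (trans (coeffs-cong n (f≈ Fin.zero)) (coeffs-monic v)) (tabulate-polys t (f≈ ∘ Fin.suc))

  record CommonRthPower (r : ℕ) {d} (ps : Fin d → Pol) : Set where
    constructor commonRthPower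
    field
      {base degree} : _
      degree≥1      : 1 ≤ degree
      base-degree   : HasDegree base degree
      divides-all   : ∀ i → base ^ₚ r ∣ ps i

  MonicCommonRthPower : ℕ → ∀ {d} → (Fin d → Pol) → ℕ → Set
  MonicCommonRthPower r ps k = 1 ≤ k × Σ (Vec K k) λ v → ∀ i → monic v ^ₚ r ∣ ps i

  MonicCommonRthPower? : ∀ r {d} (ps : Fin d → Pol) k → Dec (MonicCommonRthPower r ps k)
  MonicCommonRthPower? r ps k = (1 ℕP.≤? k) ×-dec
    search (Vec↔Fin k) (λ v → FinP.all? λ i → ∣? (MonicOfDegree-^ r (monic-MonicOfDegree v)) (ps i))

  CommonRthPower⇒monic : ∀ {r d} {ps : Fin d → Pol} → CommonRthPower r ps → ∃ (MonicCommonRthPower r ps)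
  CommonRthPower⇒monic {r} (commonRthPower {degree = k} k≥1 h-k hʳ∣) =
    let v , v∣h = monic-divisor h-k in k , k≥1 , v , λ i → ∣-trans (^-pres-∣ r v∣h) (hʳ∣ i)

  CommonRthPower? : ∀ r → 1 ≤ r → ∀ {d n} (ps : Fin (suc d) → Pol) → MonicOfDegree (ps Fin.zero) n →
    Dec (CommonRthPower r ps)
  CommonRthPower? r r≥1 {n = n} ps p₀-n with ℕP.anyUpTo? (MonicCommonRthPower? r ps) (suc n)
  ... | yes (k , _ , k≥1 , v , vʳ∣) = yes (commonRthPower k≥1 (Monic⇒HasDegree (monic-MonicOfDegree v)) vʳ∣)
  ... | no none = no λ common →
    let k , k≥1 , v , vʳ∣ = CommonRthPower⇒monic common
    in none (k , s≤s (k≤n v (vʳ∣ Fin.zero)) , k≥1 , v , vʳ∣)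
    where
    k≤n : ∀ {k} (v : Vec K k) → monic v ^ₚ r ∣ ps Fin.zero → k ≤ n
    k≤n {k} v vʳ∣p₀ = ℕP.≤-trans (ℕP.m≤n*m k r {{ℕ.>-nonZero r≥1}})
      (∣⇒degree≤ vʳ∣p₀ (Monic⇒HasDegree (MonicOfDegree-^ r (monic-MonicOfDegree v))) (Monic⇒HasDegree p₀-n))

  record Gcd {d} (ps : Fin d → Pol) : Set where
    constructor gcd
    field
      {degree}     : ℕ
      coefficients : Vec K degree
      divides-all  : ∀ i → monic coefficients ∣ ps i
      greatest     : ∀ c → (∀ i → c ∣ ps i) → c ∣ monic coefficients

  gcd-exists : ∀ {d} {ns : Vec ℕ (suc d)} (t : Tuple ns) → Gcd (polys t)
  gcd-exists (v All.∷ All.[]) = gcd v (λ { Fin.zero → ∣-refl (monic v) }) (λ c c∣ → c∣ Fin.zero)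
  gcd-exists (v All.∷ t@(_ All.∷ _)) with gcd-exists t
  ... | gcd v′ G′∣ greatest′ with extendedGcd (<-wellFounded _) (monic-MonicOfDegree v′) (monic v)
  ...   | bezoutGcd w G∣G′ G∣v s s′ G≈sG′+s′v = gcd w G∣ greatest
    where
    G∣ : ∀ i → monic w ∣ polys (v All.∷ t) i
    G∣ Fin.zero    = G∣v
    G∣ (Fin.suc i) = ∣-trans G∣G′ (G′∣ i)
    greatest : ∀ c → (∀ i → c ∣ polys (v All.∷ t) i) → c ∣ monic w
    greatest c c∣ = ∣-resp-≈ ≈-refl (≈-sym G≈sG′+s′v) (∣-+ (∣-*ˡ s (greatest′ c (c∣ ∘ Fin.suc))) (∣-*ˡ s′ (c∣ Fin.zero)))

  ¬CommonRthPower⇒GcdRthPowerFree : ∀ r {d} {ns : Vec ℕ d} (t : Tuple ns) →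
    ¬ CommonRthPower r (polys t) → GcdRthPowerFree r t
  ¬CommonRthPower⇒GcdRthPowerFree r t no-common G (_ , G∣ , _) g g-irr gʳ∣G
    with IsIrreducible⇒degree≥1 (Irreducible⇒IsIrreducible g-irr)
  ... | k , k≥1 , g-k = no-common (commonRthPower k≥1 g-k λ i → ∣-trans (∣ₚ⇒∣ {g ^ₚ r} {G} gʳ∣G) (∣ₚ⇒∣ {G} {polys t i} (G∣ i)))

  GcdRthPowerFree⇒¬CommonRthPower : ∀ r {d} {ns : Vec ℕ (suc d)} (t : Tuple ns) →
    GcdRthPowerFree r t → ¬ CommonRthPower r (polys t)
  GcdRthPowerFree⇒¬CommonRthPower r t free common = free G G-isGCD g (IsIrreducible⇒Irreducible g-irr) gʳ∣G
    where
    open Gcd (gcd-exists t) renaming (coefficients to v; divides-all to G∣; greatest to G-greatest)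
    G = monic v
    monic-common = CommonRthPower⇒monic common
    w = proj₁ (proj₂ (proj₂ monic-common))
    wʳ∣ : ∀ i → monic w ^ₚ r ∣ polys t i
    wʳ∣ = proj₂ (proj₂ (proj₂ monic-common))
    open IrreducibleFactor (irreducible-factor (<-wellFounded _) (monic-MonicOfDegree w) (proj₁ (proj₂ monic-common)))
      renaming (factor to g; irreducible to g-irr; factor∣h to g∣w)
    G-isGCD : IsGCD G (polys t)
    G-isGCD = (_ , v , refl) , (λ i → ∣⇒∣ₚ (G∣ i)) , λ c c∣ → ∣⇒∣ₚ (G-greatest c λ i → ∣ₚ⇒∣ {c} {polys t i} (c∣ i))
    gʳ∣G : (g ^ₚ r) ∣ₚ G
    gʳ∣G = ∣⇒∣ₚ (G-greatest (g ^ₚ r) λ i → ∣-trans (^-pres-∣ r g∣w) (wʳ∣ i))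

  -- Factoring out the largest common r-th power

  record RthPowerDecomposition (r : ℕ) {d} (ps : Fin d → Pol) : Set where
    constructor decomposition
    field
      {degree}       : ℕ
      coefficients   : Vec K degree
      cofactors      : Fin d → Pol
      cofactors-free : ¬ CommonRthPower r cofactors
      ps≈            : ∀ i → ps i ≈ monic coefficients ^ₚ r *ₚ cofactors i

  decompose : ∀ r → 1 ≤ r → ∀ {d n} {ps : Fin (suc d) → Pol} → Acc _<_ n → MonicOfDegree (ps Fin.zero) n →
    RthPowerDecomposition r ps
  decompose r r≥1 {n = n} {ps} (acc rec) p₀-n with CommonRthPower? r r≥1 ps p₀-n
  ... | no no-common = decomposition Vec.[] ps no-common λ i → ≈-sym (≈-trans (*-congˡ (ps i) (1^ r)) (*-identityˡ (ps i)))
  ... | yes common   = factor-out (CommonRthPower⇒monic common)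
    where
    factor-out : ∃ (MonicCommonRthPower r ps) → RthPowerDecomposition r ps
    factor-out (k , k≥1 , v , vʳ∣) = decomposition (coeffs (k ℕ.+ k′) (monic v *ₚ monic h)) u u-free ps≈
      where
      w : Fin _ → Pol
      w i = _∣_.quotient (vʳ∣ i)
      w₀-monic = quotient-monic (MonicOfDegree-^ r (monic-MonicOfDegree v)) (MonicOfDegree-cong (≈-sym (_∣_.equality (vʳ∣ Fin.zero))) p₀-n)
      b = proj₁ w₀-monic
      b<n : b < n
      b<n = subst (b <_) (proj₂ (proj₂ w₀-monic)) (ℕP.m<n+m b (ℕP.*-mono-≤ r≥1 k≥1))
      open RthPowerDecomposition (decompose r r≥1 {ps = w} (rec b<n) (proj₁ (proj₂ w₀-monic)))
        renaming (degree to k′; coefficients to h; cofactors to u; cofactors-free to u-free; ps≈ to w≈hʳu)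
      ps≈ : ∀ i → ps i ≈ monic (coeffs (k ℕ.+ k′) (monic v *ₚ monic h)) ^ₚ r *ₚ u i
      ps≈ i = begin
        ps i                                   ≈⟨ _∣_.equality (vʳ∣ i) ⟨
        monic v ^ₚ r *ₚ w i                    ≈⟨ *-congʳ (monic v ^ₚ r) (w≈hʳu i) ⟩
        monic v ^ₚ r *ₚ (monic h ^ₚ r *ₚ u i)  ≈⟨ *-assoc (monic v ^ₚ r) _ _ ⟨
        monic v ^ₚ r *ₚ monic h ^ₚ r *ₚ u i    ≈⟨ *-congˡ (u i) (^-distribʳ-* (monic v) (monic h) r) ⟨
        (monic v *ₚ monic h) ^ₚ r *ₚ u i       ≈⟨ *-congˡ (u i) (^-cong r (monic-coeffs _ vh-monic)) ⟨
        monic (coeffs (k ℕ.+ k′) (monic v *ₚ monic h)) ^ₚ r *ₚ u i ∎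
        where
        open ≈-Reasoning
        vh-monic = MonicOfDegree-* (monic-MonicOfDegree v) (monic-MonicOfDegree h)

  ^-*-cancel : ∀ r {d} {U W : Fin d → Pol} {H₁ H₂ k₁ k₂} → Acc _<_ k₁ → MonicOfDegree H₁ k₁ → MonicOfDegree H₂ k₂ →
    ¬ CommonRthPower r U → ¬ CommonRthPower r W → (∀ i → H₁ ^ₚ r *ₚ U i ≈ H₂ ^ₚ r *ₚ W i) → H₁ ≈ H₂
  ^-*-cancel r {k₁ = zero} {zero} _ H₁-0 H₂-0 _ _ _ = ≈-trans (≈-sym (monic-coeffs 0 H₁-0)) (monic-coeffs 0 H₂-0)
  ^-*-cancel r {U = U} {W} {H₁} {H₂} {zero} {suc k₂} _ H₁-0 H₂-k₂ U-free _ H₁ʳU≈H₂ʳW =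
    ⊥-elim (U-free (commonRthPower (s≤s z≤n) (Monic⇒HasDegree H₂-k₂) λ i → divides (W i) (≈-sym (U≈H₂ʳW i))))
    where
    U≈H₂ʳW : ∀ i → U i ≈ H₂ ^ₚ r *ₚ W i
    U≈H₂ʳW i = ≈-trans (≈-sym (*-identityˡ (U i)))
      (≈-trans (*-congˡ (U i) (≈-sym (≈-trans (^-cong r (≈-sym (monic-coeffs 0 H₁-0))) (1^ r)))) (H₁ʳU≈H₂ʳW i))
  ^-*-cancel r {U = U} {W} {H₁} {H₂} {suc k₁} (acc rec) H₁-k₁ H₂-k₂ U-free W-free H₁ʳU≈H₂ʳW
    with irreducible-factor (<-wellFounded _) H₁-k₁ (s≤s z≤n)
  ... | irreducibleFactor {g} {j} g-j j≥1 g-irr (divides E₁ gE₁≈H₁) with ∣? g-j H₂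
  ...   | yes (divides E₂ gE₂≈H₂) = ≈-trans (≈-sym gE₁≈H₁) (≈-trans (*-congʳ g E₁≈E₂) gE₂≈H₂)
    where
    E₁-monic = quotient-monic g-j (MonicOfDegree-cong (≈-sym gE₁≈H₁) H₁-k₁)
    E₂-monic = quotient-monic g-j (MonicOfDegree-cong (≈-sym gE₂≈H₂) H₂-k₂)
    E₁-smaller : proj₁ E₁-monic < suc k₁
    E₁-smaller = subst (proj₁ E₁-monic <_) (proj₂ (proj₂ E₁-monic)) (ℕP.m<n+m _ j≥1)
    gʳ*-assoc : ∀ {E H} X → g *ₚ E ≈ H → g ^ₚ r *ₚ (E ^ₚ r *ₚ X) ≈ H ^ₚ r *ₚ X
    gʳ*-assoc {E} X gE≈H = ≈-trans (≈-sym (*-assoc (g ^ₚ r) (E ^ₚ r) X))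
      (*-congˡ X (≈-trans (≈-sym (^-distribʳ-* g E r)) (^-cong r gE≈H)))
    E₁ʳU≈E₂ʳW : ∀ i → E₁ ^ₚ r *ₚ U i ≈ E₂ ^ₚ r *ₚ W i
    E₁ʳU≈E₂ʳW i = *-cancelˡ (monic⇒≉[] (MonicOfDegree-^ r g-j))
      (≈-trans (gʳ*-assoc (U i) gE₁≈H₁) (≈-trans (H₁ʳU≈H₂ʳW i) (≈-sym (gʳ*-assoc (W i) gE₂≈H₂))))
    E₁≈E₂ : E₁ ≈ E₂
    E₁≈E₂ = ^-*-cancel r (rec E₁-smaller) (proj₁ (proj₂ E₁-monic)) (proj₁ (proj₂ E₂-monic)) U-free W-free E₁ʳU≈E₂ʳW
  ...   | no g∤H₂ = ⊥-elim (W-free (commonRthPower j≥1 (Monic⇒HasDegree g-j) gʳ∣W))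
    where
    -- gʳ divides H₁ʳ·Uᵢ = H₂ʳ·Wᵢ but g does not divide H₂, so gʳ divides every Wᵢ.
    gʳ∣W : ∀ i → g ^ₚ r ∣ W i
    gʳ∣W i = ^-∣-*-coprimeˡ r g-j g-irr (g∤H₂ ∘ euclidsLemma-^ r g-j g-irr)
      (∣-resp-≈ ≈-refl (H₁ʳU≈H₂ʳW i) (∣-*ʳ (U i) (^-pres-∣ r (divides E₁ gE₁≈H₁))))

  decomposition-unique : ∀ {r d} {ps : Fin d → Pol} (D₁ D₂ : RthPowerDecomposition r ps) →
    let open RthPowerDecomposition in
    monic (coefficients D₁) ≈ monic (coefficients D₂) × (∀ i → cofactors D₁ i ≈ cofactors D₂ i)
  decomposition-unique {r} (decomposition h₁ u₁ u₁-free ps≈₁) (decomposition h₂ u₂ u₂-free ps≈₂) =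
    H₁≈H₂ , λ i → *-cancelˡ (monic⇒≉[] (MonicOfDegree-^ r (monic-MonicOfDegree h₁)))
                   (≈-trans (H₁ʳu₁≈H₂ʳu₂ i) (*-congˡ (u₂ i) (^-cong r (≈-sym H₁≈H₂))))
    where
    H₁ʳu₁≈H₂ʳu₂ : ∀ i → monic h₁ ^ₚ r *ₚ u₁ i ≈ monic h₂ ^ₚ r *ₚ u₂ i
    H₁ʳu₁≈H₂ʳu₂ i = ≈-trans (≈-sym (ps≈₁ i)) (ps≈₂ i)
    H₁≈H₂ : monic h₁ ≈ monic h₂
    H₁≈H₂ = ^-*-cancel r (<-wellFounded _) (monic-MonicOfDegree h₁) (monic-MonicOfDegree h₂) u₁-free u₂-free H₁ʳu₁≈H₂ʳu₂

  decomposeTuple : ∀ r → 1 ≤ r → ∀ {d} {ns : Vec ℕ (suc d)} (t : Tuple ns) → RthPowerDecomposition r (polys t)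
  decomposeTuple r r≥1 t = decompose r r≥1 (<-wellFounded _) (polys-monic t Fin.zero)

  module _ (r : ℕ) {X Y U : Pol} {k : ℕ} (X-k : MonicOfDegree X k) (Y-1+k : MonicOfDegree Y (suc k)) where

    ^-*-degree-suc : ∀ {n} → MonicOfDegree (X ^ₚ r *ₚ U) n → MonicOfDegree (Y ^ₚ r *ₚ U) (r ℕ.+ n)
    ^-*-degree-suc {n} XʳU-n with quotient-monic (MonicOfDegree-^ r X-k) XʳU-n
    ... | b , U-b , rk+b≡n = subst (MonicOfDegree _) r[1+k]+b≡r+n (MonicOfDegree-* (MonicOfDegree-^ r Y-1+k) U-b)
      where
      r[1+k]+b≡r+n : r ℕ.* suc k ℕ.+ b ≡ r ℕ.+ n
      r[1+k]+b≡r+n = trans (cong (ℕ._+ b) (ℕP.*-suc r k)) (trans (ℕP.+-assoc r (r ℕ.* k) b) (cong (r ℕ.+_) rk+b≡n))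

    ^-*-degree-pred : ∀ {n} → MonicOfDegree (Y ^ₚ r *ₚ U) (r ℕ.+ n) → MonicOfDegree (X ^ₚ r *ₚ U) n
    ^-*-degree-pred {n} YʳU-r+n with quotient-monic (MonicOfDegree-^ r Y-1+k) YʳU-r+n
    ... | b , U-b , r[1+k]+b≡r+n = subst (MonicOfDegree _) rk+b≡n (MonicOfDegree-* (MonicOfDegree-^ r X-k) U-b)
      where
      rk+b≡n : r ℕ.* k ℕ.+ b ≡ n
      rk+b≡n = ℕP.+-cancelˡ-≡ r _ _
        (trans (sym (ℕP.+-assoc r (r ℕ.* k) b)) (trans (cong (ℕ._+ b) (sym (ℕP.*-suc r k))) r[1+k]+b≡r+n))

  module _ (r : ℕ) (r≥1 : 1 ≤ r) {d : ℕ} (ms : Vec ℕ (suc d)) where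
    open RthPowerDecomposition

    private
      ns = Vec.map (r ℕ.+_) ms

      lookup-ns : ∀ i → Vec.lookup ns i ≡ r ℕ.+ Vec.lookup ms i
      lookup-ns i = VecP.lookup-map i (r ℕ.+_) ms

    -- monic (c ∷ h) is c + x·monic h, so a decomposition Hʳ·u of a tuple of degrees mᵢ becomes the
    -- tuple (c + x·H)ʳ·u of degrees r + mᵢ.
    raise : K → ∀ {ps : Fin (suc d) → Pol} → RthPowerDecomposition r ps → Tuple ns
    raise c D = tabulateTuple ns λ i → monic (c Vec.∷ coefficients D) ^ₚ r *ₚ cofactors D i

    polys-raise : ∀ c (t′ : Tuple ms) (D : RthPowerDecomposition r (polys t′)) i →
      polys (raise c D) i ≈ monic (c Vec.∷ coefficients D) ^ₚ r *ₚ cofactors D i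
    polys-raise c t′ (decomposition h u _ t′≈) = polys-tabulate ns λ i →
      subst (MonicOfDegree _) (sym (lookup-ns i))
        (^-*-degree-suc r (monic-MonicOfDegree h) (monic-MonicOfDegree (c Vec.∷ h)) (MonicOfDegree-cong (t′≈ i) (polys-monic t′ i)))

    raise-decomposition : ∀ c (t′ : Tuple ms) (D : RthPowerDecomposition r (polys t′)) →
      RthPowerDecomposition r (polys (raise c D))
    raise-decomposition c t′ D = decomposition (c Vec.∷ coefficients D) (cofactors D) (cofactors-free D) (polys-raise c t′ D)

    toCommon : K × Tuple ms → Tuple ns
    toCommon (c , t′) = raise c (decomposeTuple r r≥1 t′)

    -- Junk value on tuples without a common r-th power (H of degree 0).
    lower : ∀ {ps : Fin (suc d) → Pol} → RthPowerDecomposition r ps → K × Tuple ms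
    lower (decomposition Vec.[]        _ _ _) = 0# , tabulateTuple ms λ _ → []
    lower (decomposition (c Vec.∷ h) u _ _) = c , tabulateTuple ms λ i → monic h ^ₚ r *ₚ u i

    fromCommon : Tuple ns → K × Tuple ms
    fromCommon t = lower (decomposeTuple r r≥1 t)

    toCommon-common : ∀ x → CommonRthPower r (polys (toCommon x))
    toCommon-common (c , t′) = commonRthPower (s≤s z≤n) (Monic⇒HasDegree (monic-MonicOfDegree (c Vec.∷ h)))
      λ i → divides (cofactors D i) (≈-sym (polys-raise c t′ D i))
      where
      D = decomposeTuple r r≥1 t′
      h = coefficients D

    lower-raise : ∀ c (t′ : Tuple ms) (D : RthPowerDecomposition r (polys t′)) (D′ : RthPowerDecomposition r (polys (raise c D))) →
      lower D′ ≡ (c , t′)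
    lower-raise c t′ D D′ = lower-unique D′ (decomposition-unique D′ (raise-decomposition c t′ D))
      where
      H = monic (c Vec.∷ coefficients D)
      lower-unique : (D′ : RthPowerDecomposition r (polys (raise c D))) →
        monic (coefficients D′) ≈ H × (∀ i → cofactors D′ i ≈ cofactors D i) → lower D′ ≡ (c , t′)
      lower-unique (decomposition Vec.[] _ _ _) (1≈H , _) = ⊥-elim (ℕP.0≢1+n (HasDegree-unique
        (Monic⇒HasDegree (MonicOfDegree-cong 1≈H (monic-MonicOfDegree Vec.[])))
        (Monic⇒HasDegree (monic-MonicOfDegree (c Vec.∷ coefficients D)))))
      lower-unique (decomposition (c′ Vec.∷ h′) u′ _ _) (H′≈H , u′≈u) = cong₂ _,_ (coeff-≡ H′≈H 0)
        (tabulate-polys t′ λ i → ≈-trans (*-cong (^-cong r (tail-cong H′≈H)) (u′≈u i)) (≈-sym (ps≈ D i)))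

    fromCommon-toCommon : ∀ x → fromCommon (toCommon x) ≡ x
    fromCommon-toCommon (c , t′) = lower-raise c t′ (decomposeTuple r r≥1 t′) (decomposeTuple r r≥1 (toCommon (c , t′)))

    raise-lower : ∀ (t : Tuple ns) → CommonRthPower r (polys t) → (D : RthPowerDecomposition r (polys t)) →
      toCommon (lower D) ≡ t
    raise-lower t common (decomposition Vec.[] u u-free t≈1u) = ⊥-elim (u-free (commonRthPower degree≥1 base-degree
      λ i → ∣-resp-≈ ≈-refl (≈-trans (t≈1u i) (≈-trans (*-congˡ (u i) (1^ r)) (*-identityˡ (u i)))) (divides-all i)))
      where open CommonRthPower common
    raise-lower t _ (decomposition (c Vec.∷ h) u u-free t≈) =
      tabulate-polys t λ i → ≈-trans (*-cong (^-cong r (∷-cong refl H″≈H)) (u″≈u i)) (≈-sym (t≈ i))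
      where
      t′ = tabulateTuple ms λ i → monic h ^ₚ r *ₚ u i
      polys-t′ : ∀ i → polys t′ i ≈ monic h ^ₚ r *ₚ u i
      polys-t′ = polys-tabulate ms λ i → ^-*-degree-pred r (monic-MonicOfDegree h) (monic-MonicOfDegree (c Vec.∷ h))
        (subst (MonicOfDegree _) (lookup-ns i) (MonicOfDegree-cong (t≈ i) (polys-monic t i)))
      uniqueness = decomposition-unique (decomposeTuple r r≥1 t′) (decomposition h u u-free polys-t′)
      H″≈H = proj₁ uniqueness
      u″≈u = proj₂ uniqueness

    toCommon-fromCommon : ∀ t → CommonRthPower r (polys t) → toCommon (fromCommon t) ≡ t
    toCommon-fromCommon t common = raise-lower t common (decomposeTuple r r≥1 t)

-- Imported only here: inside Polynomials, _+_ and _*_ are the field operations.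
open import Data.Nat using (_+_; _*_; _∸_; _^_)
open import Data.Nat.Solver using (module +-*-Solver)
open import Data.Vec.Relation.Unary.Any as Any using (Any)
import Data.Vec.Relation.Unary.Any.Properties as AnyP

sum-map-+ : ∀ r {n} (ms : Vec ℕ n) → sum (Vec.map (r +_) ms) ≡ r * n + sum ms
sum-map-+ r Vec.[]                = sym (cong (_+ 0) (ℕP.*-zeroʳ r))
sum-map-+ r {suc n} (m Vec.∷ ms) = trans (cong (r + m +_) (sum-map-+ r ms))
  (solve 4 (λ r m n s → r :+ m :+ (r :* n :+ s) := r :* (con 1 :+ n) :+ (m :+ s)) refl r m n (sum ms))
  where open +-*-Solver

map-+-∸ : ∀ r {n} {ns : Vec ℕ n} → All (r ≤_) ns → Vec.map (r +_) (Vec.map (_∸ r) ns) ≡ ns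
map-+-∸ r All.[]            = refl
map-+-∸ r (r≤n All.∷ r≤ns) = cong₂ Vec._∷_ (ℕP.m+[n∸m]≡n r≤n) (map-+-∸ r r≤ns)

module Counting {q : ℕ} (F : FiniteField q) where
  open FiniteField F using (enumeration)
  open Poly F using (Tuple; polys; GcdRthPowerFree)
  open Polynomials F
  open Enumeration F

  CommonRthPower-count : ∀ r (r≥1 : 1 ≤ r) {d} (ms : Vec ℕ (suc d)) →
    HasCard (CommonRthPower r ∘ polys {ns = Vec.map (r +_) ms}) (q * q ^ sum ms)
  CommonRthPower-count r r≥1 ms = HasCard-image (↔-trans (enumeration ×-↔ Tuple↔Fin ms) (↔-sym FinP.*↔×))
    (toCommon r r≥1 ms) toCommon-injective (toCommon-common r r≥1 ms)
    λ t common → fromCommon r r≥1 ms t , toCommon-fromCommon r r≥1 ms t common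
    where
    toCommon-injective : Injective _≡_ _≡_ (toCommon r r≥1 ms)
    toCommon-injective {x} {y} e = trans (sym (fromCommon-toCommon r r≥1 ms x))
      (trans (cong (fromCommon r r≥1 ms) e) (fromCommon-toCommon r r≥1 ms y))

  GcdRthPowerFree-count : ∀ r (r≥1 : 1 ≤ r) {d} (ms : Vec ℕ (suc d)) → let ns = Vec.map (r +_) ms in
    HasCard (GcdRthPowerFree r {ns = ns}) (q ^ sum ns ∸ q ^ (sum ns + 1 ∸ r * suc d))
  GcdRthPowerFree-count r r≥1 {d} ms = subst (HasCard (GcdRthPowerFree r {ns = ns}) ∘ (q ^ sum ns ∸_) ∘ (q ^_)) 1+Σms≡Σns+1∸rd
    (HasCard-resp (¬CommonRthPower⇒GcdRthPowerFree r {ns = ns}) (GcdRthPowerFree⇒¬CommonRthPower r {ns = ns})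
      (HasCard-∁ (Tuple↔Fin ns) (λ t → CommonRthPower? r r≥1 (polys t) (polys-monic t Fin.zero)) (CommonRthPower-count r r≥1 ms)))
    where
    ns = Vec.map (r +_) ms
    1+Σms≡Σns+1∸rd : suc (sum ms) ≡ sum ns + 1 ∸ r * suc d
    1+Σms≡Σns+1∸rd = sym (begin
      sum ns + 1 ∸ r * suc d            ≡⟨ cong (λ s → s + 1 ∸ r * suc d) (sum-map-+ r ms) ⟩
      r * suc d + sum ms + 1 ∸ r * suc d ≡⟨ cong (_∸ r * suc d) (ℕP.+-assoc (r * suc d) (sum ms) 1) ⟩
      r * suc d + (sum ms + 1) ∸ r * suc d ≡⟨ ℕP.m+n∸m≡n (r * suc d) (sum ms + 1) ⟩
      sum ms + 1                         ≡⟨ ℕP.+-comm (sum ms) 1 ⟩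
      suc (sum ms)                       ∎)
      where open ≡-Reasoning

  GcdRthPowerFree-count-low : ∀ r {d} (ns : Vec ℕ d) → Any (_< r) ns → HasCard (GcdRthPowerFree r {ns = ns}) (q ^ sum ns)
  GcdRthPowerFree-count-low r ns nᵢ<r = HasCard-image (Tuple↔Fin ns) id id
    (λ t → ¬CommonRthPower⇒GcdRthPowerFree r t (no-common t)) (λ t _ → t , refl)
    where
    i = Any.index nᵢ<r
    -- A common r-th power of a polynomial of degree k ≥ 1 has degree r·k ≥ r > nᵢ.
    no-common : ∀ t → ¬ CommonRthPower r (polys t)
    no-common t (commonRthPower {degree = k} k≥1 h-k hʳ∣) = ℕP.<⇒≱ (AnyP.lookup-index nᵢ<r)
      (ℕP.≤-trans (ℕP.m≤m*n r k {{ℕ.>-nonZero k≥1}})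
        (∣⇒degree≤ (hʳ∣ i) (HasDegree-^ r h-k) (Monic⇒HasDegree (polys-monic t i))))

proposition4p1 : (q : ℕ) → IsPrimePower q → (F : FiniteField q) →
    (d r : ℕ) → 1 ≤ d → 1 ≤ r → (ns : Vec ℕ d) →
    let open Poly F in
    (All (r ≤_) ns →
      HasCard (GcdRthPowerFree r {d} {ns}) (q ^ sum ns ∸ q ^ (sum ns + 1 ∸ r * d))) ×
    (Any (_< r) ns →
      HasCard (GcdRthPowerFree r {d} {ns}) (q ^ sum ns))
proposition4p1 q _ F (suc d) r (s≤s z≤n) r≥1 ns =
  (λ ns≥r → subst Claim (map-+-∸ r ns≥r) (GcdRthPowerFree-count r r≥1 (Vec.map (_∸ r) ns))) ,
  GcdRthPowerFree-count-low r ns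
  where
  open Poly F using (GcdRthPowerFree)
  open Counting F
  Claim : Vec ℕ (suc d) → Set
  Claim ns = HasCard (GcdRthPowerFree r {suc d} {ns}) (q ^ sum ns ∸ q ^ (sum ns + 1 ∸ r * suc d))
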